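{- For every integer $n\geqslant 0$, (i) $\displaystyle \sum_{k=0}^\infty p\left( n-(2k)^2\right) = \frac{S_2(n)+G_2(n)+p_e(n)}{2}$; (ii) $\displaystyle \sum_{k=0}^\infty p\left( n-(2k+1)^2\right) = \frac{S_2(n)+G_2(n)-p_e(n)}{2}$.
   Context: $p(m)$ denotes the number of integer partitions of $m$, with $p(0)=1$ and $p(m)=0$ for $m<0$. For a partition $\lambda$ and $r\geqslant 1$, $g_r(\lambda)$ is the smallest positive integer whose multiplicity as a part of $\lambda$ is less than $r$ (multiplicity $0$ allowed). $S_2(n)=\sum_{\lambda\vdash n} g_2(\lambda)$. $G_2(n)$ is the number of partitions $\lambda$ of $n$ with $g_2(\lambda)<g_1(\lambda)$. $p_e(n)$ is the number of partitions of $n$ into an even number of parts. -}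

module Defs where

open import Data.Nat using (ℕ; zero; suc; _+_; _*_; _∸_; _^_; _≤_; _<_; _≤ᵇ_; _<ᵇ_; _≡ᵇ_)
open import Data.Nat.Properties using (_≤?_; _<?_)
open import Data.Bool using (Bool; true; false; if_then_else_)
open import Data.List using (List; []; _∷_; _++_; map; concatMap; replicate; length; filter; upTo)
open import Relation.Nullary using (Dec; yes; no)
open import Relation.Unary using (Decidable)
open import Data.Nat.ListAction using (sum)

-- A partition is a weakly decreasing list of positive integers (its parts).
-- parts n m : the list of all partitions of n whose parts are all ≤ m,
-- each listed exactly once (part m occurs j times, the rest uses parts ≤ m-1).
parts : ℕ → ℕ → List (List ℕ)
parts zero    zero    = [] ∷ []
parts (suc _) zero    = []
parts n       (suc m) =
  concatMap (λ j → if j * suc m ≤ᵇ n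
                     then map (replicate j (suc m) ++_) (parts (n ∸ j * suc m) m)
                     else [])
            (upTo (suc n))

partitions : ℕ → List (List ℕ)
partitions n = parts n n

p : ℕ → ℕ
p n = length (partitions n)

mult : ℕ → List ℕ → ℕ
mult j []      = 0
mult j (x ∷ xs) = (if x ≡ᵇ j then 1 else 0) + mult j xs

gSearch : ℕ → List ℕ → ℕ → ℕ → ℕ
gSearch r lam zero       j = j
gSearch r lam (suc fuel) j = if mult j lam <ᵇ r then j else gSearch r lam fuel (suc j)

-- g_r(λ): smallest positive integer whose multiplicity in λ is < r.
-- Fuel length λ + 1 suffices: among 1 .. length λ + 1 some j does not occur in λ.
g : ℕ → List ℕ → ℕ
g r lam = gSearch r lam (suc (length lam)) 1

S₂ : ℕ → ℕ
S₂ n = sum (map (g 2) (partitions n))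

G₂ : ℕ → ℕ
G₂ n = length (filter (λ lam → g 2 lam <? g 1 lam) (partitions n))

Even? : ℕ → Bool
Even? zero = true
Even? (suc zero) = false
Even? (suc (suc n)) = Even? n

pₑ : ℕ → ℕ
pₑ n = length (filter (λ lam → Data.Bool._≟_ (Even? (length lam)) true) (partitions n))

-- Σ_{k ≥ 0} p(n - f(k)) where p(negative) = 0; since f(k) = (2k)^2 or (2k+1)^2
-- exceeds n for k > n, only k ∈ {0,…,n} can contribute.
sumP : (ℕ → ℕ) → ℕ → ℕ
sumP f n = sum (map (λ k → if f k ≤ᵇ n then p (n ∸ f k) else 0) (upTo (suc n)))

module Submission where

-- Both parts follow, by adding and subtracting the sums over even and odd k, from
-- S₂(n) + G₂(n) = Σ_{k ≥ 0} p(n − k²) and pₑ(n) = Σ_{k ≥ 0} (−1)^k p(n − k²).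
-- For the first, g₂(λ) + [g₂(λ) < g₁(λ)] counts the k ≥ 0 for which λ contains the staircase 1, 1, 2, 2, …, k − 1, k − 1, k
-- of size k², and the partitions containing it have generating function q^(k²) Π_i 1/(1 − q^i).
-- For the second, 2 pₑ(n) − p(n) = Σ_{λ ⊢ n} (−1)^ℓ(λ) is the coefficient of q^n in Π_k 1/(1 + q^k) = Π_k (1 − q^(2k−1)).
-- Gauss's finite identity Σ_{|k| ≤ n} (−1)^k q^(k²) [2n choose n + k] = Π_{i ≤ n} (1 − q^(2i−1)), proved by induction
-- from the q-Pascal rules, turns this into Σ_{k ∈ ℤ} (−1)^k p(n − k²), because [2n choose n + k] agrees with
-- Π_i 1/(1 − q^i) in degrees up to n − k².

open import Data.Nat using (ℕ; zero; suc; z≤n; s≤s; _≤_; _<_; _∸_; ∣_-_∣; _≤ᵇ_; _<ᵇ_; _≡ᵇ_; _≤?_; _<?_; _≟_)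
  renaming (_+_ to _+ℕ_; _*_ to _*ℕ_)
import Data.Nat.Properties as ℕ
import Data.Integer.Properties as ℤ
open import Data.Integer.Tactic.RingSolver using (solve-∀)
open import Data.Nat.Tactic.RingSolver using () renaming (solve-∀ to ℕ-solve-∀)
open import Relation.Binary.PropositionalEquality hiding (J)
open import Relation.Binary using (Setoid)
import Relation.Binary.Reasoning.Setoid
open import Relation.Nullary using (Dec; yes; no; does)
open import Relation.Nullary.Reflects using (ofʸ; ofⁿ)
open import Data.Bool as Bool using (Bool; true; false; if_then_else_; _∧_)
open import Data.List using (List; []; _∷_; _++_; map; concat; concatMap; replicate; length; filter; upTo; applyUpTo)
open import Data.List.Relation.Unary.All as All using (All; []; _∷_)
import Data.List.Relation.Unary.All.Properties as All
import Data.List.Properties as List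
open import Data.Nat.ListAction using (sum)
open import Relation.Unary using (Decidable)
open import Data.Empty using (⊥-elim)
open import Data.Sum as Sum using (_⊎_; inj₁; inj₂)
open import Data.Product using (_×_; _,_; proj₁; proj₂)
open import Function using (_∘_)
open import Defs

module PowerSeries where

  open import Data.Integer using (ℤ; +_; -_; 0ℤ; 1ℤ; _+_; _-_; _*_)

  Series : Set
  Series = ℕ → ℤ

  module ≗ = Setoid (ℕ →-setoid ℤ)
  module ≗-Reasoning = Relation.Binary.Reasoning.Setoid (ℕ →-setoid ℤ)

  infixl 6 _⊕_ _⊖_
  infixr 7 _⊙_
  infixr 8 q^_·_ 1-q^_·_ 1+q^_·_

  _⊕_ _⊖_ : Series → Series → Series
  (f ⊕ g) n = f n + g n
  (f ⊖ g) n = f n - g n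

  _⊙_ : ℤ → Series → Series
  (c ⊙ f) n = c * f n

  0ₛ 1ₛ : Series
  0ₛ _ = 0ℤ
  1ₛ zero = 1ℤ
  1ₛ (suc _) = 0ℤ

  q^_·_ : ℕ → Series → Series
  q^ zero · f = f
  (q^ suc k · f) zero = 0ℤ
  (q^ suc k · f) (suc n) = (q^ k · f) n

  1-q^_·_ 1+q^_·_ : ℕ → Series → Series
  1-q^ k · f = f ⊖ q^ k · f
  1+q^ k · f = f ⊕ q^ k · f

  ⊕-cong : ∀ {f f′ g g′} → f ≗ f′ → g ≗ g′ → f ⊕ g ≗ f′ ⊕ g′
  ⊕-cong e e′ n = cong₂ _+_ (e n) (e′ n)

  ⊕-congˡ : ∀ {f f′} g → f ≗ f′ → f ⊕ g ≗ f′ ⊕ g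
  ⊕-congˡ g e = ⊕-cong {g = g} {g} e (λ _ → refl)

  ⊕-congʳ : ∀ f {g g′} → g ≗ g′ → f ⊕ g ≗ f ⊕ g′
  ⊕-congʳ f e = ⊕-cong {f} {f} (λ _ → refl) e

  q^-cong : ∀ k {f g} → f ≗ g → q^ k · f ≗ q^ k · g
  q^-cong zero e n = e n
  q^-cong (suc k) e zero = refl
  q^-cong (suc k) e (suc n) = q^-cong k e n

  q^-distrib-⊕ : ∀ k f g → q^ k · (f ⊕ g) ≗ q^ k · f ⊕ q^ k · g
  q^-distrib-⊕ zero f g n = refl
  q^-distrib-⊕ (suc k) f g zero = refl
  q^-distrib-⊕ (suc k) f g (suc n) = q^-distrib-⊕ k f g n

  q^-distrib-⊖ : ∀ k f g → q^ k · (f ⊖ g) ≗ q^ k · f ⊖ q^ k · g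
  q^-distrib-⊖ zero f g n = refl
  q^-distrib-⊖ (suc k) f g zero = refl
  q^-distrib-⊖ (suc k) f g (suc n) = q^-distrib-⊖ k f g n

  q^-⊙ : ∀ k c f → q^ k · (c ⊙ f) ≗ c ⊙ q^ k · f
  q^-⊙ zero c f n = refl
  q^-⊙ (suc k) c f zero = sym (ℤ.*-zeroʳ c)
  q^-⊙ (suc k) c f (suc n) = q^-⊙ k c f n

  q^-0ₛ : ∀ k → q^ k · 0ₛ ≗ 0ₛ
  q^-0ₛ zero n = refl
  q^-0ₛ (suc k) zero = refl
  q^-0ₛ (suc k) (suc n) = q^-0ₛ k n

  q^-+ : ∀ a b f → q^ (a +ℕ b) · f ≗ q^ a · q^ b · f
  q^-+ zero b f n = refl
  q^-+ (suc a) b f zero = refl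
  q^-+ (suc a) b f (suc n) = q^-+ a b f n

  q^-comm : ∀ a b f → q^ a · q^ b · f ≗ q^ b · q^ a · f
  q^-comm a b f n = begin
    (q^ a · q^ b · f) n  ≡⟨ q^-+ a b f n ⟨
    (q^ (a +ℕ b) · f) n  ≡⟨ cong (λ k → (q^ k · f) n) (ℕ.+-comm a b) ⟩
    (q^ (b +ℕ a) · f) n  ≡⟨ q^-+ b a f n ⟩
    (q^ b · q^ a · f) n  ∎
    where open ≡-Reasoning

  q^-below : ∀ k f {n} → n < k → (q^ k · f) n ≡ 0ℤ
  q^-below (suc k) f {zero} _ = refl
  q^-below (suc k) f {suc n} (s≤s n<k) = q^-below k f n<k

  q^-local : ∀ k {f g} N → (∀ m → m +ℕ k ≤ N → f m ≡ g m) → (q^ k · f) N ≡ (q^ k · g) N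
  q^-local zero N e = e N (ℕ.≤-reflexive (ℕ.+-identityʳ N))
  q^-local (suc k) zero e = refl
  q^-local (suc k) (suc N) e = q^-local k N (λ m le → e m (ℕ.≤-trans (ℕ.≤-reflexive (ℕ.+-suc m k)) (s≤s le)))

  coefficient-stable : ∀ (X : ℕ → Series) → (∀ a M → M ≤ a → X (suc a) M ≡ X a M) → ∀ a M → M ≤ a → X a M ≡ X M M
  coefficient-stable X step a M M≤a = subst (λ a → X a M ≡ X M M) (ℕ.m∸n+n≡m M≤a) (above (a ∸ M))
    where
    above : ∀ d → X (d +ℕ M) M ≡ X M M
    above zero = refl
    above (suc d) = trans (step (d +ℕ M) M (ℕ.m≤n+m M d)) (above d)

  q^-fixpoint-zero : ∀ k f → f ≗ q^ suc k · f → f ≗ 0ₛ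
  q^-fixpoint-zero k f fix n = vanishes-below (suc n) n ℕ.≤-refl
    where
    vanishes-below : ∀ n m → m < n → f m ≡ 0ℤ
    vanishes-below (suc n) m (s≤s m≤n) = begin
      f m                    ≡⟨ fix m ⟩
      (q^ suc k · f) m       ≡⟨ q^-local (suc k) m below-m ⟩
      (q^ suc k · 0ₛ) m      ≡⟨ q^-0ₛ (suc k) m ⟩
      0ℤ                     ∎
      where
      open ≡-Reasoning
      below-m : ∀ i → i +ℕ suc k ≤ m → f i ≡ 0ℤ
      below-m i le = vanishes-below n i (ℕ.<-≤-trans (ℕ.<-≤-trans (ℕ.m<m+n i (s≤s z≤n)) le) m≤n)

  1-q^-cancel : ∀ k {f g} → 1-q^ suc k · f ≗ 1-q^ suc k · g → f ≗ g
  1-q^-cancel k {f} {g} e n = ℤ.i-j≡0⇒i≡j (f n) (g n) (q^-fixpoint-zero k (f ⊖ g) fix n)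
    where
    difference : ∀ a b c d → a - b ≡ c - d → a - c ≡ b - d
    difference a b c d ab≡cd = begin
      a - c                      ≡⟨ rearrange a b c d ⟩
      (a - b) - (c - d) + (b - d) ≡⟨ cong (_+ (b - d)) (ℤ.i≡j⇒i-j≡0 ab≡cd) ⟩
      0ℤ + (b - d)               ≡⟨ ℤ.+-identityˡ (b - d) ⟩
      b - d                      ∎
      where
      open ≡-Reasoning
      rearrange : ∀ a b c d → a - c ≡ (a - b) - (c - d) + (b - d)
      rearrange = solve-∀
    fix : f ⊖ g ≗ q^ suc k · (f ⊖ g)
    fix m = trans (difference (f m) ((q^ suc k · f) m) (g m) ((q^ suc k · g) m) (e m))
                  (sym (q^-distrib-⊖ (suc k) f g m))

  1-q^-of-fixpoint : ∀ k {X Y} → X ≗ Y ⊕ q^ k · X → 1-q^ k · X ≗ Y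
  1-q^-of-fixpoint k {X} {Y} e n = trans (cong (_- (q^ k · X) n) (e n)) (cancel (Y n) _)
    where
    cancel : ∀ a b → a + b - b ≡ a
    cancel = solve-∀

  fixpoint-unique : ∀ k {X T Y} → X ≗ Y ⊕ q^ suc k · X → T ≗ Y ⊕ q^ suc k · T → X ≗ T
  fixpoint-unique k {Y = Y} eX eT =
    1-q^-cancel k (≗.trans (1-q^-of-fixpoint (suc k) {Y = Y} eX) (≗.sym (1-q^-of-fixpoint (suc k) {Y = Y} eT)))

  1-q^-telescope : ∀ a b f → 1-q^ a · f ⊕ q^ a · 1-q^ b · f ≗ 1-q^ (a +ℕ b) · f
  1-q^-telescope a b f n = begin
    f n - (q^ a · f) n + (q^ a · (f ⊖ q^ b · f)) n               ≡⟨ cong (λ z → (f n - (q^ a · f) n) + z) (q^-distrib-⊖ a f (q^ b · f) n) ⟩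
    f n - (q^ a · f) n + ((q^ a · f) n - (q^ a · q^ b · f) n)    ≡⟨ ℤ.+-minus-telescope (f n) _ _ ⟩
    f n - (q^ a · q^ b · f) n                                    ≡⟨ cong (λ z → f n - z) (q^-+ a b f n) ⟨
    f n - (q^ (a +ℕ b) · f) n                                    ∎
    where open ≡-Reasoning

  1-q^-1+q^ : ∀ k f → 1-q^ k · 1+q^ k · f ≗ 1-q^ (k +ℕ k) · f
  1-q^-1+q^ k f n = begin
    (f n + (q^ k · f) n) - (q^ k · (f ⊕ q^ k · f)) n
      ≡⟨ cong (λ z → f n + (q^ k · f) n - z) (q^-distrib-⊕ k f (q^ k · f) n) ⟩
    (f n + (q^ k · f) n) - ((q^ k · f) n + (q^ k · q^ k · f) n)
      ≡⟨ cancel (f n) _ _ ⟩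
    f n - (q^ k · q^ k · f) n
      ≡⟨ cong (λ z → f n - z) (q^-+ k k f n) ⟨
    f n - (q^ (k +ℕ k) · f) n ∎
    where
    open ≡-Reasoning
    cancel : ∀ a b c → (a + b) - (b + c) ≡ a - c
    cancel = solve-∀

  record ShiftLinear (Φ : Series → Series) : Set where
    field
      cong-≗ : ∀ {f g} → f ≗ g → Φ f ≗ Φ g
      distrib-⊕ : ∀ f g → Φ (f ⊕ g) ≗ Φ f ⊕ Φ g
      distrib-⊖ : ∀ f g → Φ (f ⊖ g) ≗ Φ f ⊖ Φ g
      comm-q^ : ∀ k f → Φ (q^ k · f) ≗ q^ k · Φ f

    comm-1-q^ : ∀ k f → Φ (1-q^ k · f) ≗ 1-q^ k · Φ f
    comm-1-q^ k f n = trans (distrib-⊖ f (q^ k · f) n) (cong (λ z → Φ f n - z) (comm-q^ k f n))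

    comm-1+q^ : ∀ k f → Φ (1+q^ k · f) ≗ 1+q^ k · Φ f
    comm-1+q^ k f n = trans (distrib-⊕ f (q^ k · f) n) (cong (λ z → Φ f n + z) (comm-q^ k f n))

  open ShiftLinear

  id-shiftLinear : ShiftLinear (λ f → f)
  id-shiftLinear = record
    { cong-≗ = λ e → e
    ; distrib-⊕ = λ _ _ _ → refl
    ; distrib-⊖ = λ _ _ _ → refl
    ; comm-q^ = λ _ _ _ → refl
    }

  ∘-shiftLinear : ∀ {Φ Ψ} → ShiftLinear Φ → ShiftLinear Ψ → ShiftLinear (λ f → Φ (Ψ f))
  ∘-shiftLinear Φ Ψ = record
    { cong-≗ = λ e → cong-≗ Φ (cong-≗ Ψ e)
    ; distrib-⊕ = λ f g → ≗.trans (cong-≗ Φ (distrib-⊕ Ψ f g)) (distrib-⊕ Φ _ _)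
    ; distrib-⊖ = λ f g → ≗.trans (cong-≗ Φ (distrib-⊖ Ψ f g)) (distrib-⊖ Φ _ _)
    ; comm-q^ = λ k f → ≗.trans (cong-≗ Φ (comm-q^ Ψ k f)) (comm-q^ Φ k _)
    }

  1-q^-shiftLinear : ∀ m → ShiftLinear (1-q^ m ·_)
  1-q^-shiftLinear m = record
    { cong-≗ = λ e n → cong₂ _-_ (e n) (q^-cong m e n)
    ; distrib-⊕ = λ f g n → trans (cong (λ z → f n + g n - z) (q^-distrib-⊕ m f g n))
                                  (interchange (f n) (g n) ((q^ m · f) n) ((q^ m · g) n))
    ; distrib-⊖ = λ f g n → trans (cong (λ z → f n - g n - z) (q^-distrib-⊖ m f g n))
                                  (interchange′ (f n) (g n) ((q^ m · f) n) ((q^ m · g) n))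
    ; comm-q^ = λ k f n → trans (cong (λ z → (q^ k · f) n - z) (q^-comm m k f n)) (sym (q^-distrib-⊖ k f (q^ m · f) n))
    }
    where
    interchange : ∀ a b c d → (a + b) - (c + d) ≡ (a - c) + (b - d)
    interchange = solve-∀
    interchange′ : ∀ a b c d → (a - b) - (c - d) ≡ (a - c) - (b - d)
    interchange′ = solve-∀

  1-q^-exponent : ∀ {a b} f → a ≡ b → 1-q^ a · f ≗ 1-q^ b · f
  1-q^-exponent f refl n = refl

  1-q^-comm : ∀ a b f → 1-q^ a · 1-q^ b · f ≗ 1-q^ b · 1-q^ a · f
  1-q^-comm a b f = comm-1-q^ (1-q^-shiftLinear a) b f

  1+q^-shiftLinear : ∀ m → ShiftLinear (1+q^ m ·_)
  1+q^-shiftLinear m = record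
    { cong-≗ = λ e n → cong₂ _+_ (e n) (q^-cong m e n)
    ; distrib-⊕ = λ f g n → trans (cong (λ z → (f n + g n) + z) (q^-distrib-⊕ m f g n))
                                  (interchange (f n) (g n) ((q^ m · f) n) ((q^ m · g) n))
    ; distrib-⊖ = λ f g n → trans (cong (λ z → (f n - g n) + z) (q^-distrib-⊖ m f g n))
                                  (interchange′ (f n) (g n) ((q^ m · f) n) ((q^ m · g) n))
    ; comm-q^ = λ k f n → trans (cong (λ z → (q^ k · f) n + z) (q^-comm m k f n)) (sym (q^-distrib-⊕ k f (q^ m · f) n))
    }
    where
    interchange : ∀ a b c d → (a + b) + (c + d) ≡ (a + c) + (b + d)
    interchange = solve-∀
    interchange′ : ∀ a b c d → (a - b) + (c - d) ≡ (a + c) - (b + d)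
    interchange′ = solve-∀

module FiniteSums where

  open import Data.Integer using (ℤ; +_; -_; 0ℤ; 1ℤ; _+_; _-_; _*_)
  open PowerSeries

  ∑ : ℕ → (ℕ → ℤ) → ℤ
  ∑ zero f = 0ℤ
  ∑ (suc c) f = f 0 + ∑ c (λ j → f (suc j))

  syntax ∑ c (λ j → e) = ∑[ j < c ] e

  ∑-cong : ∀ c {f g} → (∀ j → j < c → f j ≡ g j) → ∑ c f ≡ ∑ c g
  ∑-cong zero e = refl
  ∑-cong (suc c) e = cong₂ _+_ (e 0 (s≤s z≤n)) (∑-cong c (λ j j<c → e (suc j) (s≤s j<c)))

  ∑-zero : ∀ c {f} → (∀ j → j < c → f j ≡ 0ℤ) → ∑ c f ≡ 0ℤ
  ∑-zero zero e = refl
  ∑-zero (suc c) e = cong₂ _+_ (e 0 (s≤s z≤n)) (∑-zero c (λ j j<c → e (suc j) (s≤s j<c)))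

  ∑-ones : ∀ c {f} → (∀ j → j < c → f j ≡ 1ℤ) → ∑ c f ≡ + c
  ∑-ones zero e = refl
  ∑-ones (suc c) e = trans (cong₂ _+_ (e 0 (s≤s z≤n)) (∑-ones c (λ j j<c → e (suc j) (s≤s j<c)))) (sym (ℤ.pos-+ 1 c))

  ∑-split : ∀ a b f → ∑ (a +ℕ b) f ≡ ∑ a f + ∑[ j < b ] f (a +ℕ j)
  ∑-split zero b f = sym (ℤ.+-identityˡ _)
  ∑-split (suc a) b f = trans (cong (λ z → f 0 + z) (∑-split a b (λ j → f (suc j)))) (sym (ℤ.+-assoc (f 0) _ _))

  ∑-trailing-zeros : ∀ a b f → (∀ j → a ≤ j → f j ≡ 0ℤ) → ∑ (a +ℕ b) f ≡ ∑ a f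
  ∑-trailing-zeros a b f e = begin
    ∑ (a +ℕ b) f                      ≡⟨ ∑-split a b f ⟩
    ∑ a f + ∑[ j < b ] f (a +ℕ j)     ≡⟨ cong (λ z → ∑ a f + z) (∑-zero b (λ j _ → e (a +ℕ j) (ℕ.m≤m+n a j))) ⟩
    ∑ a f + 0ℤ                        ≡⟨ ℤ.+-identityʳ _ ⟩
    ∑ a f                             ∎
    where open ≡-Reasoning

  ∑-last : ∀ c f → ∑ (suc c) f ≡ ∑ c f + f c
  ∑-last zero f = trans (ℤ.+-identityʳ (f 0)) (sym (ℤ.+-identityˡ (f 0)))
  ∑-last (suc c) f = trans (cong (λ z → f 0 + z) (∑-last c (λ j → f (suc j)))) (sym (ℤ.+-assoc (f 0) _ _))

  ∑-distrib-+ : ∀ c f g → ∑[ j < c ] (f j + g j) ≡ ∑ c f + ∑ c g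
  ∑-distrib-+ zero f g = refl
  ∑-distrib-+ (suc c) f g =
    trans (cong (λ z → (f 0 + g 0) + z) (∑-distrib-+ c (λ j → f (suc j)) (λ j → g (suc j)))) (interchange (f 0) (g 0) _ _)
    where
    interchange : ∀ a b c d → (a + b) + (c + d) ≡ (a + c) + (b + d)
    interchange = solve-∀

  ∑-*ˡ : ∀ c a f → ∑[ j < c ] (a * f j) ≡ a * ∑ c f
  ∑-*ˡ zero a f = sym (ℤ.*-zeroʳ a)
  ∑-*ˡ (suc c) a f = trans (cong (λ z → a * f 0 + z) (∑-*ˡ c a (λ j → f (suc j)))) (sym (ℤ.*-distribˡ-+ a (f 0) _))

  ∑-reverse : ∀ m f → ∑ (suc m) f ≡ ∑[ d < suc m ] f (m ∸ d)
  ∑-reverse zero f = refl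
  ∑-reverse (suc m) f = begin
    f 0 + ∑[ j < suc m ] f (suc j)
      ≡⟨ cong (λ z → f 0 + z) (∑-reverse m (λ j → f (suc j))) ⟩
    f 0 + ∑[ d < suc m ] f (suc (m ∸ d))
      ≡⟨ ℤ.+-comm (f 0) _ ⟩
    ∑[ d < suc m ] f (suc (m ∸ d)) + f 0
      ≡⟨ cong₂ _+_ (∑-cong (suc m) (λ d d≤m → cong f (sym (ℕ.+-∸-assoc 1 (ℕ.≤-pred d≤m))))) (cong f (sym (ℕ.n∸n≡0 (suc m)))) ⟩
    ∑[ d < suc m ] f (suc m ∸ d) + f (suc m ∸ suc m)
      ≡⟨ ∑-last (suc m) (λ d → f (suc m ∸ d)) ⟨
    ∑[ d < suc (suc m) ] f (suc m ∸ d) ∎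
    where open ≡-Reasoning

  ∑-even-odd : ∀ c f → ∑ (c +ℕ c) f ≡ ∑[ k < c ] f (2 *ℕ k) + ∑[ k < c ] f (2 *ℕ k +ℕ 1)
  ∑-even-odd zero f = refl
  ∑-even-odd (suc c) f = begin
    ∑ (suc c +ℕ suc c) f
      ≡⟨ cong (λ a → ∑ a f) (cong suc (ℕ.+-suc c c)) ⟩
    f 0 + (f 1 + ∑[ j < c +ℕ c ] f (2 +ℕ j))
      ≡⟨ cong (λ z → f 0 + (f 1 + z)) (∑-even-odd c (λ j → f (2 +ℕ j))) ⟩
    f 0 + (f 1 + (∑[ k < c ] f (2 +ℕ 2 *ℕ k) + ∑[ k < c ] f (2 +ℕ (2 *ℕ k +ℕ 1))))
      ≡⟨ cong₂ (λ x y → f 0 + (f 1 + (x + y))) (∑-cong c (λ k _ → cong f (even k))) (∑-cong c (λ k _ → cong f (odd k))) ⟩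
    f 0 + (f 1 + (∑[ k < c ] f (2 *ℕ suc k) + ∑[ k < c ] f (2 *ℕ suc k +ℕ 1)))
      ≡⟨ interchange (f 0) (f 1) _ _ ⟩
    ∑[ k < suc c ] f (2 *ℕ k) + ∑[ k < suc c ] f (2 *ℕ k +ℕ 1) ∎
    where
    open ≡-Reasoning
    even : ∀ k → 2 +ℕ 2 *ℕ k ≡ 2 *ℕ suc k
    even = ℕ-solve-∀
    odd : ∀ k → 2 +ℕ (2 *ℕ k +ℕ 1) ≡ 2 *ℕ suc k +ℕ 1
    odd = ℕ-solve-∀
    interchange : ∀ a b c d → a + (b + (c + d)) ≡ (a + c) + (b + d)
    interchange = solve-∀

  ∑ₛ : ℕ → (ℕ → Series) → Series
  ∑ₛ c F n = ∑[ j < c ] F j n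

  q^-∑ₛ : ∀ k c F → q^ k · ∑ₛ c F ≗ ∑ₛ c (λ j → q^ k · F j)
  q^-∑ₛ zero c F n = refl
  q^-∑ₛ (suc k) c F zero = sym (∑-zero c (λ _ _ → refl))
  q^-∑ₛ (suc k) c F (suc n) = q^-∑ₛ k c F n

  ∑∈ : {A : Set} → (A → ℤ) → List A → ℤ
  ∑∈ w [] = 0ℤ
  ∑∈ w (x ∷ xs) = w x + ∑∈ w xs

  syntax ∑∈ (λ x → e) xs = ∑[ x ∈ xs ] e

  module _ {A : Set} where

    ∑∈-++ : ∀ (w : A → ℤ) xs ys → ∑∈ w (xs ++ ys) ≡ ∑∈ w xs + ∑∈ w ys
    ∑∈-++ w [] ys = sym (ℤ.+-identityˡ _)
    ∑∈-++ w (x ∷ xs) ys = trans (cong (λ z → w x + z) (∑∈-++ w xs ys)) (sym (ℤ.+-assoc (w x) _ _))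

    ∑∈-concat : ∀ (w : A → ℤ) xss → ∑∈ w (concat xss) ≡ ∑[ xs ∈ xss ] ∑∈ w xs
    ∑∈-concat w [] = refl
    ∑∈-concat w (xs ∷ xss) = trans (∑∈-++ w xs (concat xss)) (cong (λ z → ∑∈ w xs + z) (∑∈-concat w xss))

    ∑∈-map : ∀ {B : Set} (w : B → ℤ) (f : A → B) xs → ∑∈ w (map f xs) ≡ ∑[ x ∈ xs ] w (f x)
    ∑∈-map w f [] = refl
    ∑∈-map w f (x ∷ xs) = cong (λ z → w (f x) + z) (∑∈-map w f xs)

    ∑∈-cong : ∀ {w w′ : A → ℤ} {xs} → All (λ x → w x ≡ w′ x) xs → ∑∈ w xs ≡ ∑∈ w′ xs
    ∑∈-cong [] = refl
    ∑∈-cong (e ∷ es) = cong₂ _+_ e (∑∈-cong es)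

    ∑∈-0 : ∀ (xs : List A) → ∑[ x ∈ xs ] 0ℤ ≡ 0ℤ
    ∑∈-0 [] = refl
    ∑∈-0 (x ∷ xs) = trans (ℤ.+-identityˡ _) (∑∈-0 xs)

    ∑∈-if : ∀ b (w : A → ℤ) xs → ∑[ x ∈ xs ] (if b then w x else 0ℤ) ≡ (if b then ∑∈ w xs else 0ℤ)
    ∑∈-if true w xs = refl
    ∑∈-if false w xs = ∑∈-0 xs

    ∑∈-distrib-+ : ∀ (v w : A → ℤ) xs → ∑[ x ∈ xs ] (v x + w x) ≡ ∑∈ v xs + ∑∈ w xs
    ∑∈-distrib-+ v w [] = refl
    ∑∈-distrib-+ v w (x ∷ xs) = trans (cong (λ z → (v x + w x) + z) (∑∈-distrib-+ v w xs)) (interchange (v x) (w x) _ _)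
      where
      interchange : ∀ a b c d → (a + b) + (c + d) ≡ (a + c) + (b + d)
      interchange = solve-∀

    ∑∈-neg : ∀ (w : A → ℤ) xs → ∑[ x ∈ xs ] (- w x) ≡ - ∑∈ w xs
    ∑∈-neg w [] = refl
    ∑∈-neg w (x ∷ xs) = trans (cong (λ z → - w x + z) (∑∈-neg w xs)) (sym (ℤ.neg-distrib-+ (w x) _))

    ∑∈-∑-comm : ∀ c (w : ℕ → A → ℤ) xs → ∑[ x ∈ xs ] ∑[ k < c ] w k x ≡ ∑[ k < c ] ∑∈ (w k) xs
    ∑∈-∑-comm c w [] = sym (∑-zero c (λ _ _ → refl))
    ∑∈-∑-comm c w (x ∷ xs) =
      trans (cong (λ z → ∑[ k < c ] w k x + z) (∑∈-∑-comm c w xs)) (sym (∑-distrib-+ c (λ k → w k x) (λ k → ∑∈ (w k) xs)))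

  ∑∈-applyUpTo : ∀ (h : ℕ → ℤ) f c → ∑∈ h (applyUpTo f c) ≡ ∑[ j < c ] h (f j)
  ∑∈-applyUpTo h f zero = refl
  ∑∈-applyUpTo h f (suc c) = cong (λ z → h (f 0) + z) (∑∈-applyUpTo h (f ∘ suc) c)

  indicator : Bool → ℤ
  indicator true = 1ℤ
  indicator false = 0ℤ

  +-sum-map : ∀ {A : Set} (f : A → ℕ) xs → + sum (map f xs) ≡ ∑[ x ∈ xs ] (+ f x)
  +-sum-map f [] = refl
  +-sum-map f (x ∷ xs) = trans (ℤ.pos-+ (f x) _) (cong (λ z → + f x + z) (+-sum-map f xs))

  +-length-filter : ∀ {A : Set} {P : A → Set} (P? : Decidable P) xs →
                    + length (filter P? xs) ≡ ∑[ x ∈ xs ] indicator (does (P? x))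
  +-length-filter P? [] = refl
  +-length-filter P? (x ∷ xs) with does (P? x)
  ... | true = trans (ℤ.pos-+ 1 _) (cong (λ z → 1ℤ + z) (+-length-filter P? xs))
  ... | false = trans (+-length-filter P? xs) (sym (ℤ.+-identityˡ _))

  +-length : ∀ {A : Set} (xs : List A) → + length xs ≡ ∑[ x ∈ xs ] 1ℤ
  +-length [] = refl
  +-length (x ∷ xs) = trans (ℤ.pos-+ 1 (length xs)) (cong (λ z → 1ℤ + z) (+-length xs))

module ShiftSums where

  open import Data.Integer using (ℤ; +_; -_; 0ℤ; 1ℤ; _+_; _-_; _*_)
  open PowerSeries
  open FiniteSums

  ≤ᵇ-true : ∀ {m n} → m ≤ n → (m ≤ᵇ n) ≡ true
  ≤ᵇ-true {m} {n} m≤n with m ≤ᵇ n | ℕ.≤ᵇ-reflects-≤ m n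
  ... | true  | _ = refl
  ... | false | ofⁿ m≰n = ⊥-elim (m≰n m≤n)

  ≤ᵇ-false : ∀ {m n} → n < m → (m ≤ᵇ n) ≡ false
  ≤ᵇ-false {m} {n} n<m with m ≤ᵇ n | ℕ.≤ᵇ-reflects-≤ m n
  ... | false | _ = refl
  ... | true  | ofʸ m≤n = ⊥-elim (ℕ.<⇒≱ n<m m≤n)

  ≤ᵇ-+ : ∀ k a b → ((k +ℕ a) ≤ᵇ (k +ℕ b)) ≡ (a ≤ᵇ b)
  ≤ᵇ-+ k a b with a ≤? b
  ... | yes a≤b = trans (≤ᵇ-true (ℕ.+-monoʳ-≤ k a≤b)) (sym (≤ᵇ-true a≤b))
  ... | no a≰b  = trans (≤ᵇ-false (ℕ.+-monoʳ-< k (ℕ.≰⇒> a≰b))) (sym (≤ᵇ-false (ℕ.≰⇒> a≰b)))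

  q^-coeff : ∀ k f n → (q^ k · f) n ≡ (if k ≤ᵇ n then f (n ∸ k) else 0ℤ)
  q^-coeff zero f n = refl
  q^-coeff (suc k) f zero = refl
  q^-coeff (suc k) f (suc n) = trans (q^-coeff k f n) (cong (λ b → if b then f (n ∸ k) else 0ℤ) (sym (≤ᵇ-+ 1 k n)))

  -- shiftSum K F = Σ_j q^(jK) · F j
  shiftSum : ℕ → (ℕ → Series) → Series
  shiftSum K F n = ∑[ j < suc n ] (if j *ℕ K ≤ᵇ n then F j (n ∸ j *ℕ K) else 0ℤ)

  shiftSum-cong : ∀ K {F G} → (∀ j → F j ≗ G j) → shiftSum K F ≗ shiftSum K G
  shiftSum-cong K e n = ∑-cong (suc n) (λ j _ → cong (λ z → if j *ℕ K ≤ᵇ n then z else 0ℤ) (e j (n ∸ j *ℕ K)))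

  shiftSum-unfold : ∀ k F → shiftSum (suc k) F ≗ F 0 ⊕ q^ suc k · shiftSum (suc k) (F ∘ suc)
  shiftSum-unfold k F n = cong (λ z → F 0 n + z) (trans (tail n) (sym (q^-coeff K (shiftSum K (F ∘ suc)) n)))
    where
    K = suc k
    term : ℕ → ℕ → ℤ
    term n j = if j *ℕ K ≤ᵇ n then F (suc j) (n ∸ j *ℕ K) else 0ℤ
    later : ℕ → ℕ → ℤ
    later n j = if (K +ℕ j *ℕ K) ≤ᵇ n then F (suc j) (n ∸ (K +ℕ j *ℕ K)) else 0ℤ
    shifted : ∀ n′ j → later (K +ℕ n′) j ≡ term n′ j
    shifted n′ j = trans (cong (λ b → if b then F (suc j) ((K +ℕ n′) ∸ (K +ℕ j *ℕ K)) else 0ℤ) (≤ᵇ-+ K (j *ℕ K) n′))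
                         (cong (λ z → if j *ℕ K ≤ᵇ n′ then F (suc j) z else 0ℤ) (ℕ.[m+n]∸[m+o]≡n∸o K n′ (j *ℕ K)))
    beyond : ∀ n′ j → suc n′ ≤ j → term n′ j ≡ 0ℤ
    beyond n′ j n′<j = cong (λ b → if b then F (suc j) (n′ ∸ j *ℕ K) else 0ℤ) (≤ᵇ-false (ℕ.<-≤-trans n′<j (ℕ.m≤m*n j K)))
    shifted-sum : ∀ n′ → ∑ (K +ℕ n′) (later (K +ℕ n′)) ≡ shiftSum K (F ∘ suc) ((K +ℕ n′) ∸ K)
    shifted-sum n′ = begin
      ∑ (K +ℕ n′) (later (K +ℕ n′))   ≡⟨ ∑-cong (K +ℕ n′) (λ j _ → shifted n′ j) ⟩
      ∑ (K +ℕ n′) (term n′)           ≡⟨ cong (λ c → ∑ c (term n′)) (trans (ℕ.+-comm K n′) (ℕ.+-suc n′ k)) ⟩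
      ∑ (suc n′ +ℕ k) (term n′)       ≡⟨ ∑-trailing-zeros (suc n′) k (term n′) (beyond n′) ⟩
      shiftSum K (F ∘ suc) n′         ≡⟨ cong (shiftSum K (F ∘ suc)) (ℕ.m+n∸m≡n K n′) ⟨
      shiftSum K (F ∘ suc) ((K +ℕ n′) ∸ K) ∎
      where open ≡-Reasoning
    tail : ∀ n → ∑ n (later n) ≡ (if K ≤ᵇ n then shiftSum K (F ∘ suc) (n ∸ K) else 0ℤ)
    tail n with K ≤? n
    ... | no K≰n = trans (∑-zero n (λ j _ → cong (λ b → if b then F (suc j) (n ∸ (K +ℕ j *ℕ K)) else 0ℤ)
                                                  (≤ᵇ-false (ℕ.<-≤-trans (ℕ.≰⇒> K≰n) (ℕ.m≤m+n K (j *ℕ K))))))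
                         (cong (λ b → if b then shiftSum K (F ∘ suc) (n ∸ K) else 0ℤ) (sym (≤ᵇ-false (ℕ.≰⇒> K≰n))))
    ... | yes K≤n = trans (subst (λ n → ∑ n (later n) ≡ shiftSum K (F ∘ suc) (n ∸ K)) (ℕ.m+[n∸m]≡n K≤n) (shifted-sum (n ∸ K)))
                          (cong (λ b → if b then shiftSum K (F ∘ suc) (n ∸ K) else 0ℤ) (sym (≤ᵇ-true K≤n)))

  -- Y /1-q^ K is the quotient Y/(1 − q^K) only for K ≥ 1.
  infixl 7 _/1-q^_
  _/1-q^_ : Series → ℕ → Series
  Y /1-q^ K = shiftSum K (λ _ → Y)

  /1-q^-fixpoint : ∀ k Y → Y /1-q^ suc k ≗ Y ⊕ q^ suc k · (Y /1-q^ suc k)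
  /1-q^-fixpoint k Y = shiftSum-unfold k (λ _ → Y)

  /1-q^-unique : ∀ k {Y T} → T ≗ Y ⊕ q^ suc k · T → Y /1-q^ suc k ≗ T
  /1-q^-unique k {Y} fix = fixpoint-unique k {Y = Y} (/1-q^-fixpoint k Y) fix

  shiftSum-skip : ∀ k c F Y → (∀ j → j < c → F j ≗ 0ₛ) → (∀ j → F (c +ℕ j) ≗ Y) →
                  shiftSum (suc k) F ≗ q^ (c *ℕ suc k) · (Y /1-q^ suc k)
  shiftSum-skip k zero F Y _ tail = shiftSum-cong (suc k) tail
  shiftSum-skip k (suc c) F Y zeros tail n = begin
    shiftSum (suc k) F n                                          ≡⟨ shiftSum-unfold k F n ⟩
    F 0 n + (q^ suc k · shiftSum (suc k) (F ∘ suc)) n             ≡⟨ cong₂ _+_ (zeros 0 (s≤s z≤n) n) (q^-cong (suc k) rest n) ⟩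
    0ℤ + (q^ suc k · q^ (c *ℕ suc k) · (Y /1-q^ suc k)) n         ≡⟨ ℤ.+-identityˡ _ ⟩
    (q^ suc k · q^ (c *ℕ suc k) · (Y /1-q^ suc k)) n              ≡⟨ q^-+ (suc k) (c *ℕ suc k) (Y /1-q^ suc k) n ⟨
    (q^ (suc c *ℕ suc k) · (Y /1-q^ suc k)) n                     ∎
    where
    open ≡-Reasoning
    rest : shiftSum (suc k) (F ∘ suc) ≗ q^ (c *ℕ suc k) · (Y /1-q^ suc k)
    rest = shiftSum-skip k c (F ∘ suc) Y (λ j j<c → zeros (suc j) (s≤s j<c)) tail

module Partitions where

  open import Data.Integer using (ℤ; +_; -_; 0ℤ; 1ℤ; _+_; _-_; _*_)
  open PowerSeries
  open FiniteSums
  open ShiftSums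

  Bounded : ℕ → List ℕ → Set
  Bounded m μ = All (_≤ m) μ

  withCopies : ℕ → ℕ → ℕ → List (List ℕ)
  withCopies n m j = if j *ℕ suc m ≤ᵇ n then map (replicate j (suc m) ++_) (parts (n ∸ j *ℕ suc m) m) else []

  parts-suc : ∀ n m → parts n (suc m) ≡ concatMap (withCopies n m) (upTo (suc n))
  parts-suc zero m = refl
  parts-suc (suc n) m = refl

  parts-bounded : ∀ n m → All (Bounded m) (parts n m)
  parts-bounded zero zero = [] ∷ []
  parts-bounded (suc n) zero = []
  parts-bounded n (suc m) rewrite parts-suc n m = All.concat⁺ (All.map⁺ (All.applyUpTo⁺₂ (λ j → j) (suc n) bounded))
    where
    bounded : ∀ j → All (Bounded (suc m)) (withCopies n m j)
    bounded j with j *ℕ suc m ≤ᵇ n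
    ... | false = []
    ... | true = All.map⁺ (All.map (λ b → All.++⁺ (All.replicate⁺ j ℕ.≤-refl) (All.map ℕ.m≤n⇒m≤1+n b))
                                   (parts-bounded (n ∸ j *ℕ suc m) m))

  genFun : (List ℕ → ℤ) → ℕ → Series
  genFun w m n = ∑∈ w (parts n m)

  genFun-cong : ∀ {w w′} m → (∀ μ → Bounded m μ → w μ ≡ w′ μ) → genFun w m ≗ genFun w′ m
  genFun-cong m e n = ∑∈-cong (All.map (λ {μ} → e μ) (parts-bounded n m))

  genFun-suc : ∀ w (w′ : ℕ → List ℕ → ℤ) m → (∀ j μ → Bounded m μ → w (replicate j (suc m) ++ μ) ≡ w′ j μ) →
               genFun w (suc m) ≗ shiftSum (suc m) (λ j → genFun (w′ j) m)
  genFun-suc w w′ m e n = begin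
    ∑∈ w (parts n (suc m))                                    ≡⟨ cong (∑∈ w) (parts-suc n m) ⟩
    ∑∈ w (concat (map (withCopies n m) (upTo (suc n))))       ≡⟨ ∑∈-concat w (map (withCopies n m) (upTo (suc n))) ⟩
    ∑[ P ∈ map (withCopies n m) (upTo (suc n)) ] ∑∈ w P       ≡⟨ ∑∈-map (∑∈ w) (withCopies n m) (upTo (suc n)) ⟩
    ∑[ j ∈ upTo (suc n) ] ∑∈ w (withCopies n m j)             ≡⟨ ∑∈-applyUpTo (λ j → ∑∈ w (withCopies n m j)) (λ j → j) (suc n) ⟩
    ∑[ j < suc n ] ∑∈ w (withCopies n m j)                    ≡⟨ ∑-cong (suc n) (λ j _ → copies j) ⟩
    shiftSum (suc m) (λ j → genFun (w′ j) m) n                ∎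
    where
    open ≡-Reasoning
    copies : ∀ j → ∑∈ w (withCopies n m j) ≡ (if j *ℕ suc m ≤ᵇ n then genFun (w′ j) m (n ∸ j *ℕ suc m) else 0ℤ)
    copies j with j *ℕ suc m ≤ᵇ n
    ... | false = refl
    ... | true = trans (∑∈-map w (replicate j (suc m) ++_) (parts (n ∸ j *ℕ suc m) m))
                       (genFun-cong m (e j) (n ∸ j *ℕ suc m))

  Q : ℕ → Series
  Q = genFun (λ _ → 1ℤ)

  Q-zero : Q 0 ≗ 1ₛ
  Q-zero zero = refl
  Q-zero (suc n) = refl

  Q-suc : ∀ m → Q (suc m) ≗ Q m ⊕ q^ suc m · Q (suc m)
  Q-suc m n = begin
    Q (suc m) n                                    ≡⟨ Q-/1-q^ n ⟩
    (Q m /1-q^ suc m) n                            ≡⟨ /1-q^-fixpoint m (Q m) n ⟩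
    Q m n + (q^ suc m · (Q m /1-q^ suc m)) n       ≡⟨ cong (λ z → Q m n + z) (q^-cong (suc m) (≗.sym Q-/1-q^) n) ⟩
    Q m n + (q^ suc m · Q (suc m)) n               ∎
    where
    open ≡-Reasoning
    Q-/1-q^ : Q (suc m) ≗ Q m /1-q^ suc m
    Q-/1-q^ = genFun-suc (λ _ → 1ℤ) (λ _ _ → 1ℤ) m (λ _ _ _ → refl)

  /1-q^-shifted-Q : ∀ m s Y → Y ≗ q^ s · Q m → Y /1-q^ suc m ≗ q^ s · Q (suc m)
  /1-q^-shifted-Q m s Y e = /1-q^-unique m {Y = Y} fix
    where
    fix : q^ s · Q (suc m) ≗ Y ⊕ q^ suc m · q^ s · Q (suc m)
    fix n = begin
      (q^ s · Q (suc m)) n                                      ≡⟨ q^-cong s (Q-suc m) n ⟩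
      (q^ s · (Q m ⊕ q^ suc m · Q (suc m))) n                   ≡⟨ q^-distrib-⊕ s (Q m) _ n ⟩
      (q^ s · Q m) n + (q^ s · q^ suc m · Q (suc m)) n          ≡⟨ cong₂ _+_ (sym (e n)) (q^-comm s (suc m) (Q (suc m)) n) ⟩
      Y n + (q^ suc m · q^ s · Q (suc m)) n                     ∎
      where open ≡-Reasoning

  p≡Q : ∀ n → + p n ≡ Q n n
  p≡Q n = +-length (partitions n)

  Q-constant : ∀ a → Q a 0 ≡ 1ℤ
  Q-constant zero = Q-zero 0
  Q-constant (suc a) = trans (Q-suc a 0) (trans (ℤ.+-identityʳ _) (Q-constant a))

  Q-stable-suc : ∀ a M → M ≤ a → Q (suc a) M ≡ Q a M
  Q-stable-suc a M M≤a = trans (Q-suc a M) (trans (cong (λ z → Q a M + z) (q^-below (suc a) (Q (suc a)) (s≤s M≤a))) (ℤ.+-identityʳ _))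

  Q-stable : ∀ a M → M ≤ a → Q a M ≡ Q M M
  Q-stable = coefficient-stable Q Q-stable-suc

module Staircase where

  open import Data.Integer using (ℤ; +_; -_; 0ℤ; 1ℤ; _+_; _-_; _*_)
  open PowerSeries
  open FiniteSums
  open ShiftSums
  open Partitions

  ≡ᵇ-refl : ∀ a → (a ≡ᵇ a) ≡ true
  ≡ᵇ-refl zero = refl
  ≡ᵇ-refl (suc a) = ≡ᵇ-refl a

  ≡ᵇ-false : ∀ {a b} → a ≢ b → (a ≡ᵇ b) ≡ false
  ≡ᵇ-false {a} {b} a≢b with a ≡ᵇ b | ℕ.≡ᵇ⇒≡ a b
  ... | false | _ = refl
  ... | true | a≡b = ⊥-elim (a≢b (a≡b _))

  mult-++ : ∀ i xs ys → mult i (xs ++ ys) ≡ mult i xs +ℕ mult i ys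
  mult-++ i [] ys = refl
  mult-++ i (x ∷ xs) ys =
    trans (cong ((if x ≡ᵇ i then 1 else 0) +ℕ_) (mult-++ i xs ys)) (sym (ℕ.+-assoc (if x ≡ᵇ i then 1 else 0) _ _))

  mult-replicate : ∀ j M → mult M (replicate j M) ≡ j
  mult-replicate zero M = refl
  mult-replicate (suc j) M rewrite ≡ᵇ-refl M = cong suc (mult-replicate j M)

  mult-replicate-≢ : ∀ i j {M} → M ≢ i → mult i (replicate j M) ≡ 0
  mult-replicate-≢ i zero M≢i = refl
  mult-replicate-≢ i (suc j) M≢i rewrite ≡ᵇ-false M≢i = mult-replicate-≢ i j M≢i

  mult-bounded : ∀ {m} i μ → Bounded m μ → m < i → mult i μ ≡ 0
  mult-bounded i [] [] m<i = refl
  mult-bounded {m} i (x ∷ μ) (x≤m ∷ b) m<i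
    rewrite ≡ᵇ-false {x} {i} (λ x≡i → ℕ.<⇒≱ m<i (subst (_≤ m) x≡i x≤m)) = mult-bounded i μ b m<i

  mult-add-smaller : ∀ i j M μ → i < M → mult i (replicate j M ++ μ) ≡ mult i μ
  mult-add-smaller i j M μ i<M =
    trans (mult-++ i (replicate j M) μ) (cong (_+ℕ mult i μ) (mult-replicate-≢ i j (λ M≡i → ℕ.<⇒≢ i<M (sym M≡i))))

  mult-add-new : ∀ j m μ → Bounded m μ → mult (suc m) (replicate j (suc m) ++ μ) ≡ j
  mult-add-new j m μ b = begin
    mult (suc m) (replicate j (suc m) ++ μ)                ≡⟨ mult-++ (suc m) (replicate j (suc m)) μ ⟩
    mult (suc m) (replicate j (suc m)) +ℕ mult (suc m) μ   ≡⟨ cong₂ _+ℕ_ (mult-replicate j (suc m)) (mult-bounded (suc m) μ b ℕ.≤-refl) ⟩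
    j +ℕ 0                                                 ≡⟨ ℕ.+-identityʳ j ⟩
    j                                                      ∎
    where open ≡-Reasoning

  doubled : ℕ → List ℕ → Bool
  doubled zero μ = true
  doubled (suc i) μ = doubled i μ ∧ (2 ≤ᵇ mult (suc i) μ)

  -- staircase k μ says that μ contains the parts 1, 1, 2, 2, …, k−1, k−1, k, whose sum is k².
  staircase : ℕ → List ℕ → Bool
  staircase zero μ = true
  staircase (suc k) μ = doubled k μ ∧ (1 ≤ᵇ mult (suc k) μ)

  doubled-add-larger : ∀ i j m μ → i ≤ m → doubled i (replicate j (suc m) ++ μ) ≡ doubled i μ
  doubled-add-larger zero j m μ _ = refl
  doubled-add-larger (suc i) j m μ i<m =
    cong₂ _∧_ (doubled-add-larger i j m μ (ℕ.<⇒≤ i<m)) (cong (2 ≤ᵇ_) (mult-add-smaller (suc i) j (suc m) μ (s≤s i<m)))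

  doubled-add-new : ∀ j m μ → Bounded m μ → doubled (suc m) (replicate j (suc m) ++ μ) ≡ doubled m μ ∧ (2 ≤ᵇ j)
  doubled-add-new j m μ b = cong₂ _∧_ (doubled-add-larger m j m μ ℕ.≤-refl) (cong (2 ≤ᵇ_) (mult-add-new j m μ b))

  staircase-add-larger : ∀ k j m μ → k ≤ m → staircase k (replicate j (suc m) ++ μ) ≡ staircase k μ
  staircase-add-larger zero j m μ _ = refl
  staircase-add-larger (suc k) j m μ k<m =
    cong₂ _∧_ (doubled-add-larger k j m μ (ℕ.<⇒≤ k<m)) (cong (1 ≤ᵇ_) (mult-add-smaller (suc k) j (suc m) μ (s≤s k<m)))

  staircase-add-new : ∀ j m μ → Bounded m μ → staircase (suc m) (replicate j (suc m) ++ μ) ≡ doubled m μ ∧ (1 ≤ᵇ j)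
  staircase-add-new j m μ b = cong₂ _∧_ (doubled-add-larger m j m μ ℕ.≤-refl) (cong (1 ≤ᵇ_) (mult-add-new j m μ b))

  indicator-∧ : ∀ a b → indicator (a ∧ b) ≡ (if b then indicator a else 0ℤ)
  indicator-∧ true true = refl
  indicator-∧ true false = refl
  indicator-∧ false true = refl
  indicator-∧ false false = refl

  count : (List ℕ → Bool) → ℕ → Series
  count c = genFun (indicator ∘ c)

  count-new-part : ∀ c i t s → (∀ j μ → Bounded i μ → c (replicate j (suc i) ++ μ) ≡ doubled i μ ∧ (t ≤ᵇ j)) →
                  count (doubled i) i ≗ q^ s · Q i → count c (suc i) ≗ q^ (t *ℕ suc i +ℕ s) · Q (suc i)
  count-new-part c i t s new IH n = begin
    count c (suc i) n
      ≡⟨ genFun-suc (indicator ∘ c) w′ i w′-spec n ⟩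
    shiftSum (suc i) (λ j → genFun (w′ j) i) n
      ≡⟨ shiftSum-cong (suc i) (λ j x → ∑∈-if (t ≤ᵇ j) (indicator ∘ doubled i) (parts x i)) n ⟩
    shiftSum (suc i) F n
      ≡⟨ shiftSum-skip i t F Y below (λ j _ → cong (λ b → if b then _ else 0ℤ) (≤ᵇ-true (ℕ.m≤m+n t j))) n ⟩
    (q^ (t *ℕ suc i) · (Y /1-q^ suc i)) n
      ≡⟨ q^-cong (t *ℕ suc i) (/1-q^-shifted-Q i s Y IH) n ⟩
    (q^ (t *ℕ suc i) · q^ s · Q (suc i)) n
      ≡⟨ q^-+ (t *ℕ suc i) s (Q (suc i)) n ⟨
    (q^ (t *ℕ suc i +ℕ s) · Q (suc i)) n ∎
    where
    open ≡-Reasoning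
    Y = count (doubled i) i
    w′ : ℕ → List ℕ → ℤ
    w′ j μ = if t ≤ᵇ j then indicator (doubled i μ) else 0ℤ
    w′-spec : ∀ j μ → Bounded i μ → indicator (c (replicate j (suc i) ++ μ)) ≡ w′ j μ
    w′-spec j μ b = trans (cong indicator (new j μ b)) (indicator-∧ (doubled i μ) (t ≤ᵇ j))
    F : ℕ → Series
    F j x = if t ≤ᵇ j then Y x else 0ℤ
    below : ∀ j → j < t → F j ≗ 0ₛ
    below j j<t x = cong (λ b → if b then Y x else 0ℤ) (≤ᵇ-false j<t)

  count-extend : ∀ c i s → (∀ m j μ → i ≤ m → Bounded m μ → c (replicate j (suc m) ++ μ) ≡ c μ) →
                 count c i ≗ q^ s · Q i → ∀ m → i ≤ m → count c m ≗ q^ s · Q m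
  count-extend c i s larger base m i≤m = subst (λ m → count c m ≗ q^ s · Q m) (ℕ.m∸n+n≡m i≤m) (above (m ∸ i))
    where
    above : ∀ d → count c (d +ℕ i) ≗ q^ s · Q (d +ℕ i)
    above zero = base
    above (suc d) = ≗.trans (genFun-suc (indicator ∘ c) (λ _ → indicator ∘ c) (d +ℕ i) invariant)
                            (/1-q^-shifted-Q (d +ℕ i) s (count c (d +ℕ i)) (above d))
      where
      invariant : ∀ j μ → Bounded (d +ℕ i) μ → indicator (c (replicate j (suc (d +ℕ i)) ++ μ)) ≡ indicator (c μ)
      invariant j μ b = cong indicator (larger (d +ℕ i) j μ (ℕ.m≤n+m i d) b)

  count-doubled-diag : ∀ i → count (doubled i) i ≗ q^ (i *ℕ suc i) · Q i
  count-doubled-diag zero n = refl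
  count-doubled-diag (suc i) =
    ≗.trans (count-new-part (doubled (suc i)) i 2 (i *ℕ suc i) (λ j μ → doubled-add-new j i μ) (count-doubled-diag i))
            (λ n → cong (λ e → (q^ e · Q (suc i)) n) (exponent i))
    where
    exponent : ∀ i → 2 *ℕ suc i +ℕ i *ℕ suc i ≡ suc i *ℕ suc (suc i)
    exponent = ℕ-solve-∀

  count-staircase : ∀ k m → k ≤ m → count (staircase k) m ≗ q^ (k *ℕ k) · Q m
  count-staircase zero m _ n = refl
  count-staircase (suc k) =
    count-extend (staircase (suc k)) (suc k) (suc k *ℕ suc k) (λ m j μ k<m _ → staircase-add-larger (suc k) j m μ k<m) diag
    where
    exponent : ∀ k → 1 *ℕ suc k +ℕ k *ℕ suc k ≡ suc k *ℕ suc k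
    exponent = ℕ-solve-∀
    diag : count (staircase (suc k)) (suc k) ≗ q^ (suc k *ℕ suc k) · Q (suc k)
    diag = ≗.trans (count-new-part (staircase (suc k)) k 1 (k *ℕ suc k) (λ j μ → staircase-add-new j k μ)
                                   (count-doubled-diag k))
                   (λ n → cong (λ e → (q^ e · Q (suc k)) n) (exponent k))

module SmallestGap where

  open import Data.Integer using (ℤ; +_; -_; 0ℤ; 1ℤ; _+_; _-_; _*_)
  open PowerSeries
  open FiniteSums
  open ShiftSums using (≤ᵇ-true; ≤ᵇ-false)
  open Partitions using (Bounded; parts-bounded; Q)
  open Staircase

  hits : ℕ → ℕ → ℕ → ℕ
  hits x a zero = 0
  hits x a (suc c) = (if x ≡ᵇ a then 1 else 0) +ℕ hits x (suc a) c

  occurrences : ℕ → ℕ → List ℕ → ℕ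
  occurrences a zero μ = 0
  occurrences a (suc c) μ = mult a μ +ℕ occurrences (suc a) c μ

  hits-below : ∀ x a c → x < a → hits x a c ≡ 0
  hits-below x a zero x<a = refl
  hits-below x a (suc c) x<a rewrite ≡ᵇ-false (ℕ.<⇒≢ x<a) = hits-below x (suc a) c (ℕ.m<n⇒m<1+n x<a)

  hits-≤1 : ∀ x a c → hits x a c ≤ 1
  hits-≤1 x a zero = z≤n
  hits-≤1 x a (suc c) with x ≟ a
  ... | yes refl rewrite ≡ᵇ-refl x | hits-below x (suc x) c ℕ.≤-refl = ℕ.≤-refl
  ... | no x≢a rewrite ≡ᵇ-false x≢a = hits-≤1 x (suc a) c

  occurrences-∷ : ∀ x a c μ → occurrences a c (x ∷ μ) ≡ hits x a c +ℕ occurrences a c μ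
  occurrences-∷ x a zero μ = refl
  occurrences-∷ x a (suc c) μ rewrite occurrences-∷ x (suc a) c μ = interchange (if x ≡ᵇ a then 1 else 0) (mult a μ) _ _
    where
    interchange : ∀ u v w z → (u +ℕ v) +ℕ (w +ℕ z) ≡ (u +ℕ w) +ℕ (v +ℕ z)
    interchange = ℕ-solve-∀

  occurrences-≤-length : ∀ a c μ → occurrences a c μ ≤ length μ
  occurrences-≤-length a c [] = ℕ.≤-reflexive (zero-occurrences c a)
    where
    zero-occurrences : ∀ c a → occurrences a c [] ≡ 0
    zero-occurrences zero a = refl
    zero-occurrences (suc c) a = zero-occurrences c (suc a)
  occurrences-≤-length a c (x ∷ μ) rewrite occurrences-∷ x a c μ = ℕ.+-mono-≤ (hits-≤1 x a c) (occurrences-≤-length a c μ)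

  occurrences-≥ : ∀ a c μ → (∀ i → i < c → 1 ≤ mult (a +ℕ i) μ) → c ≤ occurrences a c μ
  occurrences-≥ a zero μ _ = z≤n
  occurrences-≥ a (suc c) μ present =
    ℕ.+-mono-≤ (subst (λ i → 1 ≤ mult i μ) (ℕ.+-identityʳ a) (present 0 (s≤s z≤n)))
               (occurrences-≥ (suc a) c μ (λ i i<c → subst (λ k → 1 ≤ mult k μ) (ℕ.+-suc a i) (present (suc i) (s≤s i<c))))

  gSearch-≥ : ∀ r μ fuel j → j ≤ gSearch r μ fuel j
  gSearch-≥ r μ zero j = ℕ.≤-refl
  gSearch-≥ r μ (suc fuel) j with mult j μ <ᵇ r
  ... | true = ℕ.≤-refl
  ... | false = ℕ.<⇒≤ (gSearch-≥ r μ fuel (suc j))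

  gSearch-below : ∀ r μ fuel j i → j ≤ i → i < gSearch r μ fuel j → r ≤ mult i μ
  gSearch-below r μ zero j i j≤i i<j = ⊥-elim (ℕ.<⇒≱ i<j j≤i)
  gSearch-below r μ (suc fuel) j i j≤i i<res with mult j μ <ᵇ r | ℕ.<ᵇ-reflects-< (mult j μ) r
  ... | true | _ = ⊥-elim (ℕ.<⇒≱ i<res j≤i)
  ... | false | ofⁿ j≮r with j ≟ i
  ...   | yes refl = ℕ.≮⇒≥ j≮r
  ...   | no j≢i = gSearch-below r μ fuel (suc j) i (ℕ.≤∧≢⇒< j≤i j≢i) i<res

  gSearch-stop : ∀ r μ fuel j → mult (gSearch r μ fuel j) μ < r ⊎ gSearch r μ fuel j ≡ fuel +ℕ j
  gSearch-stop r μ zero j = inj₂ refl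
  gSearch-stop r μ (suc fuel) j with mult j μ <ᵇ r | ℕ.<ᵇ-reflects-< (mult j μ) r
  ... | true | ofʸ j<r = inj₁ j<r
  ... | false | _ = Sum.map₂ (λ e → trans e (ℕ.+-suc fuel j)) (gSearch-stop r μ fuel (suc j))

  g-positive : ∀ r μ → 1 ≤ g r μ
  g-positive r μ = gSearch-≥ r μ (suc (length μ)) 1

  g-below : ∀ r μ i → 1 ≤ i → i < g r μ → r ≤ mult i μ
  g-below r μ = gSearch-below r μ (suc (length μ)) 1

  -- The search for g r μ cannot run out of fuel: 1, …, length μ + 1 cannot all be parts of μ.
  g-at : ∀ r μ → 1 ≤ r → mult (g r μ) μ < r
  g-at r μ 1≤r with gSearch-stop r μ (suc (length μ)) 1
  ... | inj₁ lt = lt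
  ... | inj₂ exhausted =
    ⊥-elim (ℕ.<⇒≱ (s≤s ℕ.≤-refl) (ℕ.≤-trans (occurrences-≥ 1 (suc (length μ)) μ present) (occurrences-≤-length 1 (suc (length μ)) μ)))
    where
    present : ∀ i → i < suc (length μ) → 1 ≤ mult (1 +ℕ i) μ
    present i i<L = ℕ.≤-trans 1≤r (g-below r μ (suc i) (s≤s z≤n)
                      (subst (suc i <_) (sym exhausted) (ℕ.≤-trans (s≤s i<L) (ℕ.≤-reflexive (ℕ.+-comm 1 (suc (length μ)))))))

  module _ (μ : List ℕ) where

    doubled-below-g₂ : ∀ i → i < g 2 μ → doubled i μ ≡ true
    doubled-below-g₂ zero _ = refl
    doubled-below-g₂ (suc i) i<G rewrite doubled-below-g₂ i (ℕ.<-trans (ℕ.n<1+n i) i<G) =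
      ≤ᵇ-true (g-below 2 μ (suc i) (s≤s z≤n) i<G)

    doubled-from-g₂ : ∀ i → g 2 μ ≤ i → doubled i μ ≡ false
    doubled-from-g₂ zero G≤0 = ⊥-elim (ℕ.<⇒≱ (g-positive 2 μ) G≤0)
    doubled-from-g₂ (suc i) G≤i with g 2 μ ≟ suc i
    ... | yes G≡i rewrite doubled-below-g₂ i (subst (i <_) (sym G≡i) (ℕ.n<1+n i)) =
      ≤ᵇ-false (subst (λ k → mult k μ < 2) G≡i (g-at 2 μ (s≤s z≤n)))
    ... | no G≢i rewrite doubled-from-g₂ i (ℕ.≤-pred (ℕ.≤∧≢⇒< G≤i G≢i)) = refl

    staircase-below-g₂ : ∀ k → k < g 2 μ → staircase k μ ≡ true
    staircase-below-g₂ zero _ = refl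
    staircase-below-g₂ (suc k) k<G rewrite doubled-below-g₂ k (ℕ.<-trans (ℕ.n<1+n k) k<G) =
      ≤ᵇ-true (ℕ.≤-trans (s≤s z≤n) (g-below 2 μ (suc k) (s≤s z≤n) k<G))

    staircase-above-g₂ : ∀ k → g 2 μ < k → staircase k μ ≡ false
    staircase-above-g₂ (suc k) G<k rewrite doubled-from-g₂ k (ℕ.≤-pred G<k) = refl

    staircase-at-g₂ : staircase (g 2 μ) μ ≡ (1 ≤ᵇ mult (g 2 μ) μ)
    staircase-at-g₂ = at (g 2 μ) refl (g-positive 2 μ)
      where
      at : ∀ G → G ≡ g 2 μ → 1 ≤ G → staircase G μ ≡ (1 ≤ᵇ mult G μ)
      at (suc k) k+1≡G _ rewrite doubled-below-g₂ k (subst (k <_) k+1≡G (ℕ.n<1+n k)) = refl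

    -- Below g₂ every part occurs twice, so g₁ ≥ g₂, and g₁ ≠ g₂ exactly when g₂ is a part.
    g₂<g₁-iff-part : does (g 2 μ <? g 1 μ) ≡ (1 ≤ᵇ mult (g 2 μ) μ)
    g₂<g₁-iff-part = decide (g 2 μ <? g 1 μ) (1 ≤? mult (g 2 μ) μ)
      where
      G = g 2 μ
      decide : Dec (G < g 1 μ) → Dec (1 ≤ mult G μ) → (suc G ≤ᵇ g 1 μ) ≡ (1 ≤ᵇ mult G μ)
      decide (yes G<g₁) (yes 1≤m) = trans (≤ᵇ-true G<g₁) (sym (≤ᵇ-true 1≤m))
      decide (no G≮g₁) (no 1≰m) = trans (≤ᵇ-false (s≤s (ℕ.≮⇒≥ G≮g₁))) (sym (≤ᵇ-false (ℕ.≰⇒> 1≰m)))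
      decide (yes G<g₁) (no 1≰m) = ⊥-elim (1≰m (g-below 1 μ G (g-positive 2 μ) G<g₁))
      decide (no G≮g₁) (yes 1≤m) with g 1 μ ≟ G
      ... | yes g₁≡G = ⊥-elim (ℕ.<⇒≱ (g-at 1 μ (s≤s z≤n)) (subst (λ k → 1 ≤ mult k μ) (sym g₁≡G) 1≤m))
      ... | no g₁≢G = ⊥-elim (ℕ.<⇒≱ (g-at 1 μ (s≤s z≤n))
                        (ℕ.≤-trans (s≤s z≤n) (g-below 2 μ (g 1 μ) (g-positive 1 μ) (ℕ.≤∧≢⇒< (ℕ.≮⇒≥ G≮g₁) g₁≢G))))

    g₂-bounded : ∀ M → Bounded M μ → g 2 μ ≤ suc M
    g₂-bounded M b with g 2 μ ≤? suc M
    ... | yes G≤ = G≤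
    ... | no G≰ = ⊥-elim (ℕ.<⇒≱ (s≤s z≤n)
                    (subst (2 ≤_) (mult-bounded (suc M) μ b ℕ.≤-refl) (g-below 2 μ (suc M) (s≤s z≤n) (ℕ.≰⇒> G≰))))

    -- μ contains the staircase of size k² exactly when k < g₂(μ), or k = g₂(μ) and g₂(μ) is a part of μ.
    g₂+[g₂<g₁]≡staircases : ∀ M → Bounded M μ →
      + g 2 μ + indicator (does (g 2 μ <? g 1 μ)) ≡ ∑[ k < suc M ] indicator (staircase k μ)
    g₂+[g₂<g₁]≡staircases M b = begin
      + G + indicator (does (G <? g 1 μ))
        ≡⟨ cong₂ _+_ (sym (∑-ones G (λ k k<G → cong indicator (staircase-below-g₂ k k<G)))) (cong indicator g₂<g₁-iff-part) ⟩
      ∑ G h + indicator (1 ≤ᵇ mult G μ)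
        ≡⟨ cong (λ z → ∑ G h + z) (sym (from-g₂ (suc M ∸ G) refl)) ⟩
      ∑ G h + ∑[ j < suc M ∸ G ] h (G +ℕ j)
        ≡⟨ ∑-split G (suc M ∸ G) h ⟨
      ∑ (G +ℕ (suc M ∸ G)) h
        ≡⟨ cong (λ c → ∑ c h) (ℕ.m+[n∸m]≡n (g₂-bounded M b)) ⟩
      ∑ (suc M) h ∎
      where
      open ≡-Reasoning
      G = g 2 μ
      h : ℕ → ℤ
      h k = indicator (staircase k μ)
      from-g₂ : ∀ c → suc M ∸ G ≡ c → ∑[ j < c ] h (G +ℕ j) ≡ indicator (1 ≤ᵇ mult G μ)
      from-g₂ zero none = cong (λ m → indicator (1 ≤ᵇ m)) (sym (mult-bounded G μ b M<G))
        where
        M<G : M < G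
        M<G = ℕ.≤-trans (ℕ.m≤n+m∸n (suc M) G) (ℕ.≤-reflexive (trans (cong (G +ℕ_) none) (ℕ.+-identityʳ G)))
      from-g₂ (suc c) _ = begin
        h (G +ℕ 0) + ∑[ j < c ] h (G +ℕ suc j)
          ≡⟨ cong₂ _+_ (trans (cong h (ℕ.+-identityʳ G)) (cong indicator staircase-at-g₂))
                       (∑-zero c (λ j _ → cong indicator (staircase-above-g₂ (G +ℕ suc j) (ℕ.m<m+n G (s≤s z≤n))))) ⟩
        indicator (1 ≤ᵇ mult G μ) + 0ℤ
          ≡⟨ ℤ.+-identityʳ _ ⟩
        indicator (1 ≤ᵇ mult G μ) ∎

  S₂+G₂≡staircases : ∀ n → + S₂ n + + G₂ n ≡ ∑[ k < suc n ] (q^ (k *ℕ k) · Q n) n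
  S₂+G₂≡staircases n = begin
    + S₂ n + + G₂ n
      ≡⟨ cong₂ _+_ (+-sum-map (g 2) (partitions n)) (+-length-filter (λ μ → g 2 μ <? g 1 μ) (partitions n)) ⟩
    ∑[ μ ∈ partitions n ] (+ g 2 μ) + ∑[ μ ∈ partitions n ] indicator (does (g 2 μ <? g 1 μ))
      ≡⟨ ∑∈-distrib-+ (λ μ → + g 2 μ) (λ μ → indicator (does (g 2 μ <? g 1 μ))) (partitions n) ⟨
    ∑[ μ ∈ partitions n ] (+ g 2 μ + indicator (does (g 2 μ <? g 1 μ)))
      ≡⟨ ∑∈-cong (All.map (λ {μ} → g₂+[g₂<g₁]≡staircases μ n) (parts-bounded n n)) ⟩
    ∑[ μ ∈ partitions n ] ∑[ k < suc n ] indicator (staircase k μ)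
      ≡⟨ ∑∈-∑-comm (suc n) (λ k μ → indicator (staircase k μ)) (partitions n) ⟩
    ∑[ k < suc n ] count (staircase k) n n
      ≡⟨ ∑-cong (suc n) (λ k k≤n → count-staircase k n (ℕ.≤-pred k≤n) n) ⟩
    ∑[ k < suc n ] (q^ (k *ℕ k) · Q n) n ∎
    where open ≡-Reasoning

module GaussianBinomials where

  open import Data.Integer using (ℤ; +_; -_; 0ℤ; 1ℤ; _+_; _-_; _*_)
  open PowerSeries
  open FiniteSums
  open ShiftLinear

  -- qBinomial a b is the Gaussian binomial coefficient [a + b choose a].
  qBinomial : ℕ → ℕ → Series
  qBinomial zero b = 1ₛ
  qBinomial (suc a) zero = 1ₛ
  qBinomial (suc a) (suc b) = qBinomial a (suc b) ⊕ q^ suc a · qBinomial (suc a) b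

  1-q^-⊕q^ : ∀ k c X Y → 1-q^ k · (X ⊕ q^ c · Y) ≗ 1-q^ k · X ⊕ q^ c · 1-q^ k · Y
  1-q^-⊕q^ k c X Y n = trans (distrib-⊕ (1-q^-shiftLinear k) X (q^ c · Y) n)
                             (cong (λ z → (1-q^ k · X) n + z) (comm-q^ (1-q^-shiftLinear k) c Y n))

  geometric-sumˡ : ∀ b → 1-q^ 1 · qBinomial 1 b ≗ 1-q^ suc b · 1ₛ
  geometric-sumˡ zero n = refl
  geometric-sumˡ (suc b) = begin
    1-q^ 1 · (1ₛ ⊕ q^ 1 · qBinomial 1 b)            ≈⟨ 1-q^-⊕q^ 1 1 1ₛ (qBinomial 1 b) ⟩
    1-q^ 1 · 1ₛ ⊕ q^ 1 · 1-q^ 1 · qBinomial 1 b      ≈⟨ ⊕-congʳ (1-q^ 1 · 1ₛ) (q^-cong 1 (geometric-sumˡ b)) ⟩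
    1-q^ 1 · 1ₛ ⊕ q^ 1 · 1-q^ suc b · 1ₛ             ≈⟨ 1-q^-telescope 1 (suc b) 1ₛ ⟩
    1-q^ suc (suc b) · 1ₛ                            ∎
    where open ≗-Reasoning

  geometric-sumʳ : ∀ a → 1-q^ 1 · qBinomial a 1 ≗ 1-q^ suc a · 1ₛ
  geometric-sumʳ zero n = refl
  geometric-sumʳ (suc a) = begin
    1-q^ 1 · (qBinomial a 1 ⊕ q^ suc a · 1ₛ)               ≈⟨ 1-q^-⊕q^ 1 (suc a) (qBinomial a 1) 1ₛ ⟩
    1-q^ 1 · qBinomial a 1 ⊕ q^ suc a · 1-q^ 1 · 1ₛ         ≈⟨ ⊕-congˡ (q^ suc a · 1-q^ 1 · 1ₛ) (geometric-sumʳ a) ⟩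
    1-q^ suc a · 1ₛ ⊕ q^ suc a · 1-q^ 1 · 1ₛ                ≈⟨ 1-q^-telescope (suc a) 1 1ₛ ⟩
    1-q^ (suc a +ℕ 1) · 1ₛ                                  ≈⟨ 1-q^-exponent 1ₛ (ℕ.+-comm (suc a) 1) ⟩
    1-q^ suc (suc a) · 1ₛ                                   ∎
    where open ≗-Reasoning

  qBinomial-exchange : ∀ a b → 1-q^ suc b · qBinomial a (suc b) ≗ 1-q^ suc a · qBinomial (suc a) b
  qBinomial-exchange zero b = ≗.sym (geometric-sumˡ b)
  qBinomial-exchange (suc a) zero = geometric-sumʳ (suc a)
  qBinomial-exchange (suc a) (suc b) = begin
    1-q^ suc (suc b) · (U ⊕ q^ suc a · Y)
      ≈⟨ 1-q^-⊕q^ (suc (suc b)) (suc a) U Y ⟩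
    1-q^ suc (suc b) · U ⊕ q^ suc a · 1-q^ suc (suc b) · Y
      ≈⟨ ⊕-congˡ (q^ suc a · 1-q^ suc (suc b) · Y) (qBinomial-exchange a (suc b)) ⟩
    1-q^ suc a · Y ⊕ q^ suc a · 1-q^ suc (suc b) · Y
      ≈⟨ 1-q^-telescope (suc a) (suc (suc b)) Y ⟩
    1-q^ (suc a +ℕ suc (suc b)) · Y
      ≈⟨ 1-q^-exponent Y (exponent a b) ⟩
    1-q^ (suc (suc a) +ℕ suc b) · Y
      ≈⟨ 1-q^-telescope (suc (suc a)) (suc b) Y ⟨
    1-q^ suc (suc a) · Y ⊕ q^ suc (suc a) · 1-q^ suc b · Y
      ≈⟨ ⊕-congʳ (1-q^ suc (suc a) · Y) (q^-cong (suc (suc a)) (qBinomial-exchange (suc a) b)) ⟩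
    1-q^ suc (suc a) · Y ⊕ q^ suc (suc a) · 1-q^ suc (suc a) · V
      ≈⟨ 1-q^-⊕q^ (suc (suc a)) (suc (suc a)) Y V ⟨
    1-q^ suc (suc a) · (Y ⊕ q^ suc (suc a) · V) ∎
    where
    open ≗-Reasoning
    U = qBinomial a (suc (suc b))
    Y = qBinomial (suc a) (suc b)
    V = qBinomial (suc (suc a)) b
    exponent : ∀ a b → suc a +ℕ suc (suc b) ≡ suc (suc a) +ℕ suc b
    exponent = ℕ-solve-∀

  qBinomial-pascalʳ : ∀ a b → qBinomial (suc a) (suc b) ≗ q^ suc b · qBinomial a (suc b) ⊕ qBinomial (suc a) b
  qBinomial-pascalʳ a b n = swap (X n) ((q^ suc b · X) n) (Z n) ((q^ suc a · Z) n) (qBinomial-exchange a b n)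
    where
    X = qBinomial a (suc b)
    Z = qBinomial (suc a) b
    swap : ∀ x x′ z z′ → x - x′ ≡ z - z′ → x + z′ ≡ x′ + z
    swap x x′ z z′ e = begin
      x + z′                               ≡⟨ rearrange x x′ z z′ ⟩
      x′ + z + ((x - x′) - (z - z′))       ≡⟨ cong (λ d → x′ + z + d) (ℤ.i≡j⇒i-j≡0 e) ⟩
      x′ + z + 0ℤ                          ≡⟨ ℤ.+-identityʳ _ ⟩
      x′ + z                               ∎
      where
      open ≡-Reasoning
      rearrange : ∀ x x′ z z′ → x + z′ ≡ x′ + z + ((x - x′) - (z - z′))
      rearrange = solve-∀

  -- qBinomial⁺ J (M ∸ J) is [M − 2 choose J − 1] for 1 ≤ J < M and 0 for all other J.
  qBinomial⁺ : ℕ → ℕ → Series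
  qBinomial⁺ zero b = 0ₛ
  qBinomial⁺ (suc a) zero = 0ₛ
  qBinomial⁺ (suc a) (suc b) = qBinomial a b

  qBinomial⁺-zeroʳ : ∀ a → qBinomial⁺ a 0 ≗ 0ₛ
  qBinomial⁺-zeroʳ zero n = refl
  qBinomial⁺-zeroʳ (suc a) n = refl

  qBinomial-zeroʳ : ∀ a → qBinomial a 0 ≗ 1ₛ
  qBinomial-zeroʳ zero n = refl
  qBinomial-zeroʳ (suc a) n = refl

  qBinomial⁺-pascalˡ : ∀ a b → 1 ≤ a +ℕ b → qBinomial⁺ (suc a) (suc b) ≗ qBinomial⁺ a (suc b) ⊕ q^ a · qBinomial⁺ (suc a) b
  qBinomial⁺-pascalˡ zero (suc b) _ n = sym (ℤ.+-identityˡ _)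
  qBinomial⁺-pascalˡ (suc a) zero _ n =
    sym (trans (cong (λ z → qBinomial a 0 n + z) (q^-0ₛ (suc a) n)) (trans (ℤ.+-identityʳ _) (qBinomial-zeroʳ a n)))
  qBinomial⁺-pascalˡ (suc a) (suc b) _ n = refl

  qBinomial⁺-pascalʳ : ∀ a b → 1 ≤ a +ℕ b → qBinomial⁺ (suc a) (suc b) ≗ q^ b · qBinomial⁺ a (suc b) ⊕ qBinomial⁺ (suc a) b
  qBinomial⁺-pascalʳ zero (suc b) _ n = sym (trans (cong (_+ 1ₛ n) (q^-0ₛ (suc b) n)) (ℤ.+-identityˡ _))
  qBinomial⁺-pascalʳ (suc a) zero _ n = sym (trans (ℤ.+-identityʳ _) (qBinomial-zeroʳ a n))
  qBinomial⁺-pascalʳ (suc a) (suc b) _ = qBinomial-pascalʳ a b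

  private
    nonempty-row : ∀ {a M} → 2 ≤ M → a < M → 1 ≤ a +ℕ (M ∸ suc a)
    nonempty-row {suc a} _ _ = s≤s z≤n
    nonempty-row {zero} 2≤M _ = ℕ.∸-monoˡ-≤ 1 2≤M

    both-zero : ∀ {x y} → x ≡ 0ℤ → y ≡ 0ℤ → 0ℤ ≡ x + y
    both-zero refl refl = refl

  qBinomial⁺-rowˡ : ∀ a M → 2 ≤ M →
                    qBinomial⁺ (suc a) (M ∸ a) ≗ qBinomial⁺ a (M ∸ a) ⊕ q^ a · qBinomial⁺ (suc a) (M ∸ suc a)
  qBinomial⁺-rowˡ a M 2≤M n with M ≤? a
  ... | yes M≤a rewrite ℕ.m≤n⇒m∸n≡0 M≤a | ℕ.m≤n⇒m∸n≡0 (ℕ.m≤n⇒m≤1+n M≤a) =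
    both-zero (qBinomial⁺-zeroʳ a n) (trans (q^-cong a (qBinomial⁺-zeroʳ (suc a)) n) (q^-0ₛ a n))
  ... | no M≰a rewrite ℕ.+-∸-assoc 1 (ℕ.≰⇒> M≰a) = qBinomial⁺-pascalˡ a (M ∸ suc a) (nonempty-row 2≤M (ℕ.≰⇒> M≰a)) n

  qBinomial⁺-rowʳ : ∀ a M → 2 ≤ M →
                    qBinomial⁺ (suc a) (M ∸ a) ≗ q^ (M ∸ suc a) · qBinomial⁺ a (M ∸ a) ⊕ qBinomial⁺ (suc a) (M ∸ suc a)
  qBinomial⁺-rowʳ a M 2≤M n with M ≤? a
  ... | yes M≤a rewrite ℕ.m≤n⇒m∸n≡0 M≤a | ℕ.m≤n⇒m∸n≡0 (ℕ.m≤n⇒m≤1+n M≤a) =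
    both-zero (qBinomial⁺-zeroʳ a n) (qBinomial⁺-zeroʳ (suc a) n)
  ... | no M≰a rewrite ℕ.+-∸-assoc 1 (ℕ.≰⇒> M≰a) = qBinomial⁺-pascalʳ a (M ∸ suc a) (nonempty-row 2≤M (ℕ.≰⇒> M≰a)) n

  term : (ℕ → ℤ) → (ℕ → ℕ) → ℕ → ℕ → Series
  term s e M J = s J ⊙ q^ e J · qBinomial⁺ J (M ∸ J)

  row : ℕ → ℕ → (ℕ → ℤ) → (ℕ → ℕ) → Series
  row c M s e = ∑ₛ c (term s e M)

  term-vanishes : ∀ s e M J → qBinomial⁺ J (M ∸ J) ≗ 0ₛ → term s e M J ≗ 0ₛ
  term-vanishes s e M J vanish n = trans (cong (s J *_) (trans (q^-cong (e J) vanish n) (q^-0ₛ (e J) n))) (ℤ.*-zeroʳ (s J))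

  term-beyond : ∀ s e M J → M ≤ J → term s e M J ≗ 0ₛ
  term-beyond s e M J M≤J = term-vanishes s e M J (subst (λ b → qBinomial⁺ J b ≗ 0ₛ) (sym (ℕ.m≤n⇒m∸n≡0 M≤J)) (qBinomial⁺-zeroʳ J))

  term-cong : ∀ M J s s′ e e′ → (1 ≤ J → J < M → s J ≡ s′ J × e J ≡ e′ J) → term s e M J ≗ term s′ e′ M J
  term-cong M zero s s′ e e′ _ n = trans (term-vanishes s e M 0 (λ _ → refl) n) (sym (term-vanishes s′ e′ M 0 (λ _ → refl) n))
  term-cong M (suc J) s s′ e e′ agree n with suc J <? M
  ... | yes J<M = cong₂ (λ c k → c * (q^ k · qBinomial⁺ (suc J) (M ∸ suc J)) n) (proj₁ (agree (s≤s z≤n) J<M)) (proj₂ (agree (s≤s z≤n) J<M))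
  ... | no J≮M = trans (term-beyond s e M (suc J) (ℕ.≮⇒≥ J≮M) n) (sym (term-beyond s′ e′ M (suc J) (ℕ.≮⇒≥ J≮M) n))

  row-unfold : ∀ c M s e n → row (suc c) M s e n ≡ ∑[ a < c ] term s e M (suc a) n
  row-unfold c M s e n = trans (cong (_+ ∑[ a < c ] term s e M (suc a) n) (term-vanishes s e M 0 (λ _ → refl) n)) (ℤ.+-identityˡ _)

  row-cong : ∀ c M s s′ e e′ → (∀ J → 1 ≤ J → J < M → s J ≡ s′ J × e J ≡ e′ J) → row c M s e ≗ row c M s′ e′
  row-cong c M s s′ e e′ agree n = ∑-cong c (λ J _ → term-cong M J s s′ e e′ (agree J) n)

  row-drop-last : ∀ c M s e → M ≤ c → row (suc c) M s e ≗ row c M s e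
  row-drop-last c M s e M≤c n = begin
    row (suc c) M s e n                   ≡⟨ ∑-last c (λ J → term s e M J n) ⟩
    row c M s e n + term s e M c n        ≡⟨ cong (λ z → row c M s e n + z) (term-beyond s e M c M≤c n) ⟩
    row c M s e n + 0ℤ                    ≡⟨ ℤ.+-identityʳ _ ⟩
    row c M s e n                         ∎
    where open ≡-Reasoning

  ⊙q^-splitˡ : ∀ c e k X Y → c ⊙ q^ e · (X ⊕ q^ k · Y) ≗ c ⊙ q^ e · X ⊕ c ⊙ q^ (e +ℕ k) · Y
  ⊙q^-splitˡ c e k X Y n = trans (cong (c *_) (trans (q^-distrib-⊕ e X (q^ k · Y) n) (cong (λ z → (q^ e · X) n + z) (sym (q^-+ e k Y n)))))
                                 (ℤ.*-distribˡ-+ c _ _)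

  ⊙q^-splitʳ : ∀ c e k X Y → c ⊙ q^ e · (q^ k · X ⊕ Y) ≗ c ⊙ q^ (e +ℕ k) · X ⊕ c ⊙ q^ e · Y
  ⊙q^-splitʳ c e k X Y n = trans (cong (c *_) (trans (q^-distrib-⊕ e (q^ k · X) Y n) (cong (_+ (q^ e · Y) n) (sym (q^-+ e k X n)))))
                                 (ℤ.*-distribˡ-+ c _ _)

  row-pascalˡ : ∀ c M s e → 2 ≤ M →
                row (suc c) (suc M) s e ≗ row c M (s ∘ suc) (e ∘ suc) ⊕ row (suc c) M s (λ J → e J +ℕ (J ∸ 1))
  row-pascalˡ c M s e 2≤M n = begin
    row (suc c) (suc M) s e n
      ≡⟨ row-unfold c (suc M) s e n ⟩
    ∑[ a < c ] term s e (suc M) (suc a) n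
      ≡⟨ ∑-cong c (λ a _ → split a) ⟩
    ∑[ a < c ] (term (s ∘ suc) (e ∘ suc) M a n + term s e′ M (suc a) n)
      ≡⟨ ∑-distrib-+ c (λ a → term (s ∘ suc) (e ∘ suc) M a n) (λ a → term s e′ M (suc a) n) ⟩
    row c M (s ∘ suc) (e ∘ suc) n + ∑[ a < c ] term s e′ M (suc a) n
      ≡⟨ cong (λ z → row c M (s ∘ suc) (e ∘ suc) n + z) (row-unfold c M s e′ n) ⟨
    row c M (s ∘ suc) (e ∘ suc) n + row (suc c) M s e′ n ∎
    where
    open ≡-Reasoning
    e′ : ℕ → ℕ
    e′ J = e J +ℕ (J ∸ 1)
    split : ∀ a → term s e (suc M) (suc a) n ≡ term (s ∘ suc) (e ∘ suc) M a n + term s e′ M (suc a) n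
    split a = trans (cong (s (suc a) *_) (q^-cong (e (suc a)) (qBinomial⁺-rowˡ a M 2≤M) n))
                    (⊙q^-splitˡ (s (suc a)) (e (suc a)) a _ _ n)

  row-pascalʳ : ∀ c M s e → 2 ≤ M →
                row (suc c) (suc M) s e ≗ row c M (s ∘ suc) (λ J → e (suc J) +ℕ (M ∸ suc J)) ⊕ row (suc c) M s e
  row-pascalʳ c M s e 2≤M n = begin
    row (suc c) (suc M) s e n
      ≡⟨ row-unfold c (suc M) s e n ⟩
    ∑[ a < c ] term s e (suc M) (suc a) n
      ≡⟨ ∑-cong c (λ a _ → split a) ⟩
    ∑[ a < c ] (term (s ∘ suc) e′ M a n + term s e M (suc a) n)
      ≡⟨ ∑-distrib-+ c (λ a → term (s ∘ suc) e′ M a n) (λ a → term s e M (suc a) n) ⟩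
    row c M (s ∘ suc) e′ n + ∑[ a < c ] term s e M (suc a) n
      ≡⟨ cong (λ z → row c M (s ∘ suc) e′ n + z) (row-unfold c M s e n) ⟨
    row c M (s ∘ suc) e′ n + row (suc c) M s e n ∎
    where
    open ≡-Reasoning
    e′ : ℕ → ℕ
    e′ J = e (suc J) +ℕ (M ∸ suc J)
    split : ∀ a → term s e (suc M) (suc a) n ≡ term (s ∘ suc) e′ M a n + term s e M (suc a) n
    split a = trans (cong (s (suc a) *_) (q^-cong (e (suc a)) (qBinomial⁺-rowʳ a M 2≤M) n))
                    (⊙q^-splitʳ (s (suc a)) (e (suc a)) (M ∸ suc a) _ _ n)

  row-pascal² : ∀ B s e → 2 ≤ B →
    row (3 +ℕ B) (2 +ℕ B) s e ≗
      (row (suc B) B (s ∘ suc ∘ suc) (λ J → e (2 +ℕ J) +ℕ (B ∸ suc J)) ⊕ row (suc B) B (s ∘ suc) (e ∘ suc))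
      ⊕ (row (suc B) B (s ∘ suc) (λ J → e (suc J) +ℕ J) ⊕ row (suc B) B s (λ J → e J +ℕ (J ∸ 1) +ℕ (J ∸ 1)))
  row-pascal² B s e 2≤B = begin
    row (3 +ℕ B) (2 +ℕ B) s e
      ≈⟨ row-pascalˡ (2 +ℕ B) (suc B) s e (ℕ.m≤n⇒m≤1+n 2≤B) ⟩
    row (2 +ℕ B) (suc B) (s ∘ suc) (e ∘ suc) ⊕ row (3 +ℕ B) (suc B) s e′
      ≈⟨ ⊕-cong (row-pascalʳ (suc B) B (s ∘ suc) (e ∘ suc) 2≤B) (row-pascalˡ (2 +ℕ B) B s e′ 2≤B) ⟩
    (row (suc B) B (s ∘ suc ∘ suc) e₂ ⊕ row (2 +ℕ B) B (s ∘ suc) (e ∘ suc))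
      ⊕ (row (2 +ℕ B) B (s ∘ suc) (e′ ∘ suc) ⊕ row (3 +ℕ B) B s e″)
      ≈⟨ ⊕-cong (⊕-congʳ (row (suc B) B (s ∘ suc ∘ suc) e₂) (row-drop-last (suc B) B (s ∘ suc) (e ∘ suc) (ℕ.n≤1+n B)))
                (⊕-cong (row-drop-last (suc B) B (s ∘ suc) (e′ ∘ suc) (ℕ.n≤1+n B))
                        (≗.trans (row-drop-last (2 +ℕ B) B s e″ (ℕ.m≤n⇒m≤1+n (ℕ.n≤1+n B))) (row-drop-last (suc B) B s e″ (ℕ.n≤1+n B)))) ⟩
    (row (suc B) B (s ∘ suc ∘ suc) e₂ ⊕ row (suc B) B (s ∘ suc) (e ∘ suc))
      ⊕ (row (suc B) B (s ∘ suc) (e′ ∘ suc) ⊕ row (suc B) B s e″) ∎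
    where
    open ≗-Reasoning
    e′ e″ e₂ : ℕ → ℕ
    e′ J = e J +ℕ (J ∸ 1)
    e″ J = e′ J +ℕ (J ∸ 1)
    e₂ J = e (2 +ℕ J) +ℕ (B ∸ suc J)

module GaussIdentity where

  open import Data.Integer using (ℤ; +_; -_; 0ℤ; 1ℤ; _+_; _-_; _*_)
  open PowerSeries
  open FiniteSums
  open GaussianBinomials

  sign : ℕ → ℤ
  sign zero = 1ℤ
  sign (suc k) = - sign k

  sign-+-suc : ∀ a b → sign (a +ℕ suc b) ≡ - sign (a +ℕ b)
  sign-+-suc a b = cong sign (ℕ.+-suc a b)

  square : ℕ → ℕ
  square x = x *ℕ x

  sign-+ : ∀ a b → sign (a +ℕ b) ≡ sign a * sign b
  sign-+ zero b = sym (ℤ.*-identityˡ (sign b))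
  sign-+ (suc a) b = trans (cong -_ (sign-+ a b)) (ℤ.neg-distribˡ-* (sign a) (sign b))

  sign-* : ∀ a → sign a * sign a ≡ 1ℤ
  sign-* zero = refl
  sign-* (suc a) = trans (neg-square (sign a)) (sign-* a)
    where
    neg-square : ∀ x → (- x) * (- x) ≡ x * x
    neg-square = solve-∀

  sign-same-parity : ∀ a b c → a +ℕ b ≡ c +ℕ c → sign a ≡ sign b
  sign-same-parity a b c a+b≡c+c = begin
    sign a
      ≡⟨ ℤ.*-identityʳ (sign a) ⟨
    sign a * 1ℤ
      ≡⟨ cong (sign a *_) (sign-* b) ⟨
    sign a * (sign b * sign b)
      ≡⟨ ℤ.*-assoc (sign a) (sign b) (sign b) ⟨
    (sign a * sign b) * sign b
      ≡⟨ cong (_* sign b) (trans (sym (sign-+ a b)) (trans (cong sign a+b≡c+c) (trans (sign-+ c c) (sign-* c)))) ⟩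
    1ℤ * sign b
      ≡⟨ ℤ.*-identityˡ (sign b) ⟩
    sign b ∎
    where open ≡-Reasoning

  n≤square : ∀ n → n ≤ square n
  n≤square zero = z≤n
  n≤square (suc n) = ℕ.m≤m*n (suc n) (suc n)

  +-∸ : ∀ {m n} → n ≤ m → + (m ∸ n) ≡ + m - + n
  +-∸ {m} {n} n≤m = trans (sym (ℤ.⊖-≥ n≤m)) (sym (ℤ.[+m]-[+n]≡m⊖n m n))

  +-square-∣-∣ : ∀ a b → + square ∣ a - b ∣ ≡ (+ a - + b) * (+ a - + b)
  +-square-∣-∣ a b with ℕ.≤-total a b
  ... | inj₁ a≤b rewrite ℕ.m≤n⇒∣m-n∣≡n∸m a≤b =
    trans (ℤ.pos-* (b ∸ a) (b ∸ a)) (trans (cong₂ _*_ (+-∸ a≤b) (+-∸ a≤b)) (flip (+ a) (+ b)))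
    where
    flip : ∀ x y → (y - x) * (y - x) ≡ (x - y) * (x - y)
    flip = solve-∀
  ... | inj₂ b≤a rewrite ℕ.m≤n⇒∣n-m∣≡n∸m b≤a = trans (ℤ.pos-* (a ∸ b) (a ∸ b)) (cong₂ _*_ (+-∸ b≤a) (+-∸ b≤a))

  exponent-cancel : ∀ n J → J ≤ suc (n +ℕ n) → square ∣ J - n ∣ +ℕ (suc (n +ℕ n) ∸ J) ≡ square ∣ J - suc n ∣ +ℕ J
  exponent-cancel n J J≤ = ℤ.+-injective (begin
    + (square ∣ J - n ∣ +ℕ (suc (n +ℕ n) ∸ J))                 ≡⟨ ℤ.pos-+ (square ∣ J - n ∣) _ ⟩
    + square ∣ J - n ∣ + + (suc (n +ℕ n) ∸ J)                  ≡⟨ cong₂ _+_ (+-square-∣-∣ J n) (+-∸ J≤) ⟩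
    (+ J - + n) * (+ J - + n) + (+ suc (n +ℕ n) - + J)         ≡⟨ cong (λ z → (+ J - + n) * (+ J - + n) + (z - + J)) (ℤ.pos-+ 1 (n +ℕ n)) ⟩
    (+ J - + n) * (+ J - + n) + (1ℤ + + (n +ℕ n) - + J)        ≡⟨ cong (λ z → (+ J - + n) * (+ J - + n) + (1ℤ + z - + J)) (ℤ.pos-+ n n) ⟩
    (+ J - + n) * (+ J - + n) + (1ℤ + (+ n + + n) - + J)       ≡⟨ complete-square (+ J) (+ n) ⟩
    (+ J - (1ℤ + + n)) * (+ J - (1ℤ + + n)) + + J              ≡⟨ cong (_+ + J) (+-square-∣-∣ J (suc n)) ⟨
    + square ∣ J - suc n ∣ + + J                               ≡⟨ ℤ.pos-+ (square ∣ J - suc n ∣) J ⟨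
    + (square ∣ J - suc n ∣ +ℕ J)                              ∎)
    where
    open ≡-Reasoning
    complete-square : ∀ j m → (j - m) * (j - m) + (1ℤ + (m + m) - j) ≡ (j - (1ℤ + m)) * (j - (1ℤ + m)) + j
    complete-square = solve-∀

  exponent-shift : ∀ n J → 1 ≤ J →
                   square ∣ J - suc (suc n) ∣ +ℕ (J ∸ 1) +ℕ (J ∸ 1) ≡ square ∣ J - suc n ∣ +ℕ suc (n +ℕ n)
  exponent-shift n J 1≤J = ℤ.+-injective (begin
    + (square ∣ J - suc (suc n) ∣ +ℕ (J ∸ 1) +ℕ (J ∸ 1))
      ≡⟨ ℤ.pos-+ (square ∣ J - suc (suc n) ∣ +ℕ (J ∸ 1)) _ ⟩
    + (square ∣ J - suc (suc n) ∣ +ℕ (J ∸ 1)) + + (J ∸ 1)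
      ≡⟨ cong (_+ + (J ∸ 1)) (ℤ.pos-+ (square ∣ J - suc (suc n) ∣) _) ⟩
    + square ∣ J - suc (suc n) ∣ + + (J ∸ 1) + + (J ∸ 1)
      ≡⟨ cong₂ (λ x y → x + y + y) (+-square-∣-∣ J (suc (suc n))) (+-∸ 1≤J) ⟩
    (+ J - + suc (suc n)) * (+ J - + suc (suc n)) + (+ J - 1ℤ) + (+ J - 1ℤ)
      ≡⟨ shift (+ J) (+ n) ⟩
    (+ J - + suc n) * (+ J - + suc n) + (1ℤ + (+ n + + n))
      ≡⟨ cong₂ _+_ (+-square-∣-∣ J (suc n)) (trans (ℤ.pos-+ 1 (n +ℕ n)) (cong (λ z → 1ℤ + z) (ℤ.pos-+ n n))) ⟨
    + square ∣ J - suc n ∣ + + suc (n +ℕ n)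
      ≡⟨ ℤ.pos-+ (square ∣ J - suc n ∣) _ ⟨
    + (square ∣ J - suc n ∣ +ℕ suc (n +ℕ n)) ∎)
    where
    open ≡-Reasoning
    shift : ∀ j m → (j - (1ℤ + (1ℤ + m))) * (j - (1ℤ + (1ℤ + m))) + (j - 1ℤ) + (j - 1ℤ) ≡ (j - (1ℤ + m)) * (j - (1ℤ + m)) + (1ℤ + (m + m))
    shift = solve-∀

  σ : ℕ → ℕ → ℤ
  σ n J = sign (J +ℕ suc n)

  ε : ℕ → ℕ → ℕ
  ε n J = square ∣ J - suc n ∣

  -- With k = J − (n + 1): gaussSum n = Σ_{|k| ≤ n} (−1)^k q^(k²) [2n choose n + k].
  gaussSum : ℕ → Series
  gaussSum n = row (3 +ℕ (n +ℕ n)) (2 +ℕ (n +ℕ n)) (σ n) (ε n)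

  oddProduct : ℕ → Series
  oddProduct zero = 1ₛ
  oddProduct (suc n) = 1-q^ suc (n +ℕ n) · oddProduct n

  gaussSum-zero : gaussSum 0 ≗ 1ₛ
  gaussSum-zero n = begin
    term (σ 0) (ε 0) 2 0 n + (1ℤ * 1ₛ n + (term (σ 0) (ε 0) 2 2 n + 0ℤ))
      ≡⟨ cong₂ (λ x y → x + (1ℤ * 1ₛ n + (y + 0ℤ))) (term-vanishes (σ 0) (ε 0) 2 0 (λ _ → refl) n)
                                                     (term-beyond (σ 0) (ε 0) 2 2 ℕ.≤-refl n) ⟩
    0ℤ + (1ℤ * 1ₛ n + (0ℤ + 0ℤ))
      ≡⟨ simplify (1ₛ n) ⟩
    1ₛ n ∎
    where
    open ≡-Reasoning
    simplify : ∀ x → 0ℤ + (1ℤ * x + (0ℤ + 0ℤ)) ≡ x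
    simplify = solve-∀

  module _ (n : ℕ) where

    private
      B = 2 +ℕ (n +ℕ n)
      K = suc (n +ℕ n)

    gaussSum-cancelling : row (suc B) B (σ (suc n) ∘ suc ∘ suc) (λ J → ε (suc n) (2 +ℕ J) +ℕ (B ∸ suc J))
                          ⊕ row (suc B) B (σ (suc n) ∘ suc) (λ J → ε (suc n) (suc J) +ℕ J) ≗ 0ₛ
    gaussSum-cancelling m = begin
      row (suc B) B s₂ e₂ m + row (suc B) B s₁ e₁ m         ≡⟨ ∑-distrib-+ (suc B) (λ J → term s₂ e₂ B J m) (λ J → term s₁ e₁ B J m) ⟨
      ∑[ J < suc B ] (term s₂ e₂ B J m + term s₁ e₁ B J m)  ≡⟨ ∑-zero (suc B) (λ J _ → opposite J) ⟩
      0ℤ                                                     ∎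
      where
      open ≡-Reasoning
      s₁ s₂ : ℕ → ℤ
      s₁ = σ (suc n) ∘ suc
      s₂ = σ (suc n) ∘ suc ∘ suc
      e₁ e₂ : ℕ → ℕ
      e₁ J = ε (suc n) (suc J) +ℕ J
      e₂ J = ε (suc n) (2 +ℕ J) +ℕ (B ∸ suc J)
      opposite : ∀ J → term s₂ e₂ B J m + term s₁ e₁ B J m ≡ 0ℤ
      opposite J = trans (cong (_+ term s₁ e₁ B J m) (term-cong B J s₂ (λ J → - s₁ J) e₂ e₁ same-exponent m))
                         (cancel (s₁ J) ((q^ e₁ J · qBinomial⁺ J (B ∸ J)) m))
        where
        same-exponent : 1 ≤ J → J < B → s₂ J ≡ - s₁ J × e₂ J ≡ e₁ J
        same-exponent _ J<B = refl , exponent-cancel n J (ℕ.≤-pred J<B)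
        cancel : ∀ x y → (- x) * y + x * y ≡ 0ℤ
        cancel = solve-∀

    gaussSum-unshifted : row (suc B) B (σ (suc n) ∘ suc) (ε (suc n) ∘ suc) ≗ gaussSum n
    gaussSum-unshifted = row-cong (suc B) B (σ (suc n) ∘ suc) (σ n) (ε (suc n) ∘ suc) (ε n) (λ J _ _ → sign-shift J , refl)
      where
      sign-shift : ∀ J → σ (suc n) (suc J) ≡ σ n J
      sign-shift J = trans (cong -_ (sign-+-suc J (suc n))) (ℤ.neg-involutive (σ n J))

    gaussSum-shifted : row (suc B) B (σ (suc n)) (λ J → ε (suc n) J +ℕ (J ∸ 1) +ℕ (J ∸ 1)) ≗ (- 1ℤ) ⊙ q^ K · gaussSum n
    gaussSum-shifted m = begin
      row (suc B) B (σ (suc n)) e m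
        ≡⟨ row-cong (suc B) B (σ (suc n)) (λ J → - σ n J) e (λ J → ε n J +ℕ K)
                    (λ J 1≤J _ → sign-+-suc J (suc n) , exponent-shift n J 1≤J) m ⟩
      ∑[ J < suc B ] ((- σ n J) * (q^ (ε n J +ℕ K) · P J) m)
        ≡⟨ ∑-cong (suc B) (λ J _ → factor J) ⟩
      ∑[ J < suc B ] ((- 1ℤ) * (q^ K · term (σ n) (ε n) B J) m)
        ≡⟨ ∑-*ˡ (suc B) (- 1ℤ) (λ J → (q^ K · term (σ n) (ε n) B J) m) ⟩
      (- 1ℤ) * ∑[ J < suc B ] (q^ K · term (σ n) (ε n) B J) m
        ≡⟨ cong ((- 1ℤ) *_) (q^-∑ₛ K (suc B) (term (σ n) (ε n) B) m) ⟨
      (- 1ℤ) * (q^ K · gaussSum n) m ∎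
      where
      open ≡-Reasoning
      e : ℕ → ℕ
      e J = ε (suc n) J +ℕ (J ∸ 1) +ℕ (J ∸ 1)
      P : ℕ → Series
      P J = qBinomial⁺ J (B ∸ J)
      factor : ∀ J → (- σ n J) * (q^ (ε n J +ℕ K) · P J) m ≡ (- 1ℤ) * (q^ K · term (σ n) (ε n) B J) m
      factor J = begin
        (- σ n J) * (q^ (ε n J +ℕ K) · P J) m               ≡⟨ cong (λ k → (- σ n J) * (q^ k · P J) m) (ℕ.+-comm (ε n J) K) ⟩
        (- σ n J) * (q^ (K +ℕ ε n J) · P J) m               ≡⟨ cong ((- σ n J) *_) (q^-+ K (ε n J) (P J) m) ⟩
        (- σ n J) * (q^ K · q^ ε n J · P J) m               ≡⟨ pull-sign (σ n J) _ ⟩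
        (- 1ℤ) * (σ n J * (q^ K · q^ ε n J · P J) m)        ≡⟨ cong ((- 1ℤ) *_) (q^-⊙ K (σ n J) (q^ ε n J · P J) m) ⟨
        (- 1ℤ) * (q^ K · term (σ n) (ε n) B J) m            ∎
        where
        pull-sign : ∀ a x → (- a) * x ≡ (- 1ℤ) * (a * x)
        pull-sign = solve-∀

    -- Expanding each [2n + 2 choose ·] twice by q-Pascal: T₁ and T₃ cancel, T₂ = gaussSum n and T₄ = −q^(2n+1) gaussSum n.
    gaussSum-suc : gaussSum (suc n) ≗ 1-q^ K · gaussSum n
    gaussSum-suc = begin
      gaussSum (suc n)
        ≈⟨ (λ m → cong (λ b → row (suc b) b (σ (suc n)) (ε (suc n)) m) (cong (2 +ℕ_) (ℕ.+-suc (suc n) n))) ⟩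
      row (3 +ℕ B) (2 +ℕ B) (σ (suc n)) (ε (suc n))
        ≈⟨ row-pascal² B (σ (suc n)) (ε (suc n)) (s≤s (s≤s z≤n)) ⟩
      (T₁ ⊕ T₂) ⊕ (T₃ ⊕ T₄)
        ≈⟨ (λ m → interchange (T₁ m) (T₂ m) (T₃ m) (T₄ m)) ⟩
      (T₁ ⊕ T₃) ⊕ (T₂ ⊕ T₄)
        ≈⟨ ⊕-cong gaussSum-cancelling (⊕-cong gaussSum-unshifted gaussSum-shifted) ⟩
      0ₛ ⊕ (gaussSum n ⊕ (- 1ℤ) ⊙ q^ K · gaussSum n)
        ≈⟨ (λ m → simplify (gaussSum n m) ((q^ K · gaussSum n) m)) ⟩
      1-q^ K · gaussSum n ∎
      where
      open ≗-Reasoning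
      T₁ = row (suc B) B (σ (suc n) ∘ suc ∘ suc) (λ J → ε (suc n) (2 +ℕ J) +ℕ (B ∸ suc J))
      T₂ = row (suc B) B (σ (suc n) ∘ suc) (ε (suc n) ∘ suc)
      T₃ = row (suc B) B (σ (suc n) ∘ suc) (λ J → ε (suc n) (suc J) +ℕ J)
      T₄ = row (suc B) B (σ (suc n)) (λ J → ε (suc n) J +ℕ (J ∸ 1) +ℕ (J ∸ 1))
      interchange : ∀ a b c d → (a + b) + (c + d) ≡ (a + c) + (b + d)
      interchange = solve-∀
      simplify : ∀ l x → 0ℤ + (l + (- 1ℤ) * x) ≡ l - x
      simplify = solve-∀

  gaussSum≗oddProduct : ∀ n → gaussSum n ≗ oddProduct n
  gaussSum≗oddProduct zero = gaussSum-zero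
  gaussSum≗oddProduct (suc n) =
    ≗.trans (gaussSum-suc n) (ShiftLinear.cong-≗ (1-q^-shiftLinear (suc (n +ℕ n))) (gaussSum≗oddProduct n))

module GaussCoefficient where

  open import Data.Integer using (ℤ; +_; -_; 0ℤ; 1ℤ; _+_; _-_; _*_)
  open PowerSeries
  open FiniteSums
  open Partitions using (Q; Q-zero; Q-suc; Q-constant; Q-stable)
  open GaussianBinomials
  open GaussIdentity

  -- qBinomial a b counts partitions into parts ≤ a with at most b parts, a bound that is void in degrees ≤ b.
  qBinomial≡Q : ∀ a b M → M ≤ b → qBinomial a b M ≡ Q a M
  qBinomial≡Q zero b M _ = sym (Q-zero M)
  qBinomial≡Q (suc a) zero zero _ = sym (Q-constant (suc a))
  qBinomial≡Q (suc a) (suc b) M M≤b =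
    trans (cong₂ _+_ (qBinomial≡Q a (suc b) M M≤b) (q^-local (suc a) M low-degrees)) (sym (Q-suc a M))
    where
    low-degrees : ∀ m → m +ℕ suc a ≤ M → qBinomial (suc a) b m ≡ Q (suc a) m
    low-degrees m le = qBinomial≡Q (suc a) b m (ℕ.≤-pred (ℕ.≤-trans (ℕ.m<m+n m (s≤s z≤n)) (ℕ.≤-trans le M≤b)))

  q^-qBinomial≡q^-Q : ∀ a b k N → N ≤ a +ℕ k → N ≤ b +ℕ k → (q^ k · qBinomial a b) N ≡ (q^ k · Q N) N
  q^-qBinomial≡q^-Q a b k N N≤a+k N≤b+k = q^-local k N agree
    where
    below : ∀ c {m} → m +ℕ k ≤ N → N ≤ c +ℕ k → m ≤ c
    below c {m} le N≤ = ℕ.+-cancelʳ-≤ k m c (ℕ.≤-trans le N≤)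
    agree : ∀ m → m +ℕ k ≤ N → qBinomial a b m ≡ Q N m
    agree m le = trans (qBinomial≡Q a b m (below b le N≤b+k))
                       (trans (Q-stable a m (below a le N≤a+k)) (sym (Q-stable N m (ℕ.≤-trans (ℕ.m≤m+n m k) le))))

  signedTerm : ℕ → ℕ → ℤ
  signedTerm N d = sign d * (q^ square d · Q N) N

  signedTerm-beyond : ∀ N d → N < d → signedTerm N d ≡ 0ℤ
  signedTerm-beyond N d N<d = trans (cong (sign d *_) (q^-below (square d) (Q N) (ℕ.<-≤-trans N<d (n≤square d)))) (ℤ.*-zeroʳ (sign d))

  gaussTerm : ℕ → ℕ → ℤ
  gaussTerm N J = term (σ N) (ε N) (2 +ℕ (N +ℕ N)) J N

  gaussTerm-left : ∀ t d → gaussTerm (t +ℕ d) (suc t) ≡ signedTerm (t +ℕ d) d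
  gaussTerm-left t d = cong₂ _*_ sign-agrees (begin
    (q^ ε N (suc t) · qBinomial⁺ (suc t) (B ∸ suc t)) N
      ≡⟨ cong (λ k → (q^ square k · qBinomial⁺ (suc t) (B ∸ suc t)) N) distance ⟩
    (q^ square d · qBinomial⁺ (suc t) (B ∸ suc t)) N
      ≡⟨ cong (λ b → (q^ square d · qBinomial⁺ (suc t) b) N) row-length ⟩
    (q^ square d · qBinomial t ((N +ℕ N) ∸ t)) N
      ≡⟨ q^-qBinomial≡q^-Q t ((N +ℕ N) ∸ t) (square d) N (ℕ.+-monoʳ-≤ t (n≤square d)) N≤b+d² ⟩
    (q^ square d · Q N) N ∎)
    where
    open ≡-Reasoning
    N = t +ℕ d
    B = 2 +ℕ (N +ℕ N)
    sign-agrees : sign (suc t +ℕ suc N) ≡ sign d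
    sign-agrees = sign-same-parity (suc t +ℕ suc N) d (suc N) (double t d)
      where
      double : ∀ t d → (suc t +ℕ suc (t +ℕ d)) +ℕ d ≡ suc (t +ℕ d) +ℕ suc (t +ℕ d)
      double = ℕ-solve-∀
    distance : ∣ t - N ∣ ≡ d
    distance = trans (ℕ.m≤n⇒∣m-n∣≡n∸m (ℕ.m≤m+n t d)) (ℕ.m+n∸m≡n t d)
    row-length : B ∸ suc t ≡ suc ((N +ℕ N) ∸ t)
    row-length = ℕ.+-∸-assoc 1 (ℕ.≤-trans (ℕ.m≤m+n t d) (ℕ.m≤m+n N N))
    N≤b+d² : N ≤ ((N +ℕ N) ∸ t) +ℕ square d
    N≤b+d² = ℕ.≤-trans (ℕ.≤-trans (ℕ.≤-reflexive (sym (ℕ.m+n∸n≡m N t))) (ℕ.∸-monoˡ-≤ t (ℕ.+-monoʳ-≤ N (ℕ.m≤m+n t d)))) (ℕ.m≤m+n _ (square d))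

  gaussTerm-right : ∀ N j → j < N → gaussTerm N (2 +ℕ (N +ℕ j)) ≡ signedTerm N (suc j)
  gaussTerm-right N j j<N = cong₂ _*_ sign-agrees (begin
    (q^ ε N J · qBinomial⁺ J (B ∸ J)) N
      ≡⟨ cong (λ k → (q^ square k · qBinomial⁺ J (B ∸ J)) N) distance ⟩
    (q^ square (suc j) · qBinomial⁺ J (B ∸ J)) N
      ≡⟨ cong (λ b → (q^ square (suc j) · qBinomial⁺ J b) N) row-length ⟩
    (q^ square (suc j) · qBinomial (suc (N +ℕ j)) (N ∸ suc j)) N
      ≡⟨ q^-qBinomial≡q^-Q (suc (N +ℕ j)) (N ∸ suc j) (square (suc j)) N N≤a+d² N≤b+d² ⟩
    (q^ square (suc j) · Q N) N ∎)
    where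
    open ≡-Reasoning
    J = 2 +ℕ (N +ℕ j)
    B = 2 +ℕ (N +ℕ N)
    sign-agrees : sign (J +ℕ suc N) ≡ sign (suc j)
    sign-agrees = sign-same-parity (J +ℕ suc N) (suc j) J (double N j)
      where
      double : ∀ N j → (2 +ℕ (N +ℕ j) +ℕ suc N) +ℕ suc j ≡ (2 +ℕ (N +ℕ j)) +ℕ (2 +ℕ (N +ℕ j))
      double = ℕ-solve-∀
    distance : ∣ suc (N +ℕ j) - N ∣ ≡ suc j
    distance = trans (cong (λ x → ∣ x - N ∣) (sym (ℕ.+-suc N j))) (trans (ℕ.m≤n⇒∣n-m∣≡n∸m (ℕ.m≤m+n N (suc j))) (ℕ.m+n∸m≡n N (suc j)))
    row-length : B ∸ J ≡ suc (N ∸ suc j)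
    row-length = trans (ℕ.[m+n]∸[m+o]≡n∸o N N j) (ℕ.+-∸-assoc 1 j<N)
    N≤a+d² : N ≤ suc (N +ℕ j) +ℕ square (suc j)
    N≤a+d² = ℕ.≤-trans (ℕ.m≤m+n N (suc j)) (ℕ.≤-trans (ℕ.≤-reflexive (ℕ.+-suc N j)) (ℕ.m≤m+n _ _))
    N≤b+d² : N ≤ (N ∸ suc j) +ℕ square (suc j)
    N≤b+d² = ℕ.≤-trans (ℕ.≤-trans (ℕ.m≤n+m∸n N (suc j)) (ℕ.≤-reflexive (ℕ.+-comm (suc j) _))) (ℕ.+-monoʳ-≤ _ (n≤square (suc j)))

  gaussTerm-lower : ∀ N d → d ≤ suc N → gaussTerm N (suc N ∸ d) ≡ signedTerm N d
  gaussTerm-lower N d d≤1+N with ℕ.m≤n⇒m<n∨m≡n d≤1+N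
  ... | inj₂ refl = trans (cong (gaussTerm N) (ℕ.n∸n≡0 (suc N)))
                          (trans (term-vanishes (σ N) (ε N) (2 +ℕ (N +ℕ N)) 0 (λ _ → refl) N) (sym (signedTerm-beyond N (suc N) ℕ.≤-refl)))
  ... | inj₁ (s≤s d≤N) = trans (cong (gaussTerm N) (ℕ.+-∸-assoc 1 d≤N))
                                (subst (λ M → gaussTerm M (suc (M ∸ d)) ≡ signedTerm M d) (ℕ.m∸n+n≡m d≤N) left)
    where
    t = N ∸ d
    left : gaussTerm (t +ℕ d) (suc ((t +ℕ d) ∸ d)) ≡ signedTerm (t +ℕ d) d
    left = trans (cong (λ z → gaussTerm (t +ℕ d) (suc z)) (ℕ.m+n∸n≡m t d)) (gaussTerm-left t d)

  gaussTerm-upper : ∀ N j → j ≤ N → gaussTerm N (2 +ℕ (N +ℕ j)) ≡ signedTerm N (suc j)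
  gaussTerm-upper N j j≤N with ℕ.m≤n⇒m<n∨m≡n j≤N
  ... | inj₁ j<N = gaussTerm-right N j j<N
  ... | inj₂ refl = trans (term-beyond (σ N) (ε N) (2 +ℕ (N +ℕ N)) (2 +ℕ (N +ℕ N)) ℕ.≤-refl N) (sym (signedTerm-beyond N (suc N) ℕ.≤-refl))

  -- Terms J = N + 1 ∓ d of gaussSum N contribute (−1)^d p(N − d²) each to the coefficient of q^N.
  gaussSum-coefficient : ∀ N → gaussSum N N ≡ signedTerm N 0 + (∑[ j < suc N ] signedTerm N (suc j) + ∑[ j < suc N ] signedTerm N (suc j))
  gaussSum-coefficient N = begin
    ∑ (3 +ℕ (N +ℕ N)) (gaussTerm N)
      ≡⟨ cong (λ c → ∑ c (gaussTerm N)) (row-size N) ⟩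
    ∑ (suc (suc N) +ℕ suc N) (gaussTerm N)
      ≡⟨ ∑-split (suc (suc N)) (suc N) (gaussTerm N) ⟩
    ∑ (suc (suc N)) (gaussTerm N) + ∑[ j < suc N ] gaussTerm N (2 +ℕ (N +ℕ j))
      ≡⟨ cong₂ _+_ (trans (∑-reverse (suc N) (gaussTerm N)) (∑-cong (suc (suc N)) (λ d d<2+N → gaussTerm-lower N d (ℕ.≤-pred d<2+N))))
                   (∑-cong (suc N) (λ j j<1+N → gaussTerm-upper N j (ℕ.≤-pred j<1+N))) ⟩
    (signedTerm N 0 + S) + S
      ≡⟨ ℤ.+-assoc (signedTerm N 0) S S ⟩
    signedTerm N 0 + (S + S) ∎
    where
    open ≡-Reasoning
    S = ∑[ j < suc N ] signedTerm N (suc j)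
    row-size : ∀ N → 3 +ℕ (N +ℕ N) ≡ suc (suc N) +ℕ suc N
    row-size = ℕ-solve-∀

module EulerProduct where

  open import Data.Integer using (ℤ; +_; -_; 0ℤ; 1ℤ; _+_; _-_; _*_)
  open PowerSeries
  open FiniteSums
  open ShiftSums
  open Partitions
  open GaussIdentity using (sign; oddProduct)
  open ShiftLinear

  signedQ′ : ℕ → ℕ → Series
  signedQ′ t = genFun (λ μ → sign (t +ℕ length μ))

  signedQ : ℕ → Series
  signedQ = signedQ′ 0

  signedQ-zero : signedQ 0 ≗ 1ₛ
  signedQ-zero zero = refl
  signedQ-zero (suc n) = refl

  signedQ′-suc : ∀ t m → signedQ′ t (suc m) ≗ shiftSum (suc m) (λ j → signedQ′ (t +ℕ j) m)
  signedQ′-suc t m = genFun-suc (λ μ → sign (t +ℕ length μ)) (λ j μ → sign ((t +ℕ j) +ℕ length μ)) m length-added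
    where
    length-added : ∀ j μ → Bounded m μ → sign (t +ℕ length (replicate j (suc m) ++ μ)) ≡ sign ((t +ℕ j) +ℕ length μ)
    length-added j μ _ = cong sign (begin
      t +ℕ length (replicate j (suc m) ++ μ)         ≡⟨ cong (t +ℕ_) (List.length-++ (replicate j (suc m))) ⟩
      t +ℕ (length (replicate j (suc m)) +ℕ length μ) ≡⟨ cong (λ l → t +ℕ (l +ℕ length μ)) (List.length-replicate j) ⟩
      t +ℕ (j +ℕ length μ)                           ≡⟨ ℕ.+-assoc t j (length μ) ⟨
      (t +ℕ j) +ℕ length μ                           ∎)
      where open ≡-Reasoning

  1+q^-signedQ : ∀ m → 1+q^ suc m · signedQ (suc m) ≗ signedQ m
  1+q^-signedQ m n = begin
    signedQ (suc m) n + (q^ suc m · signedQ (suc m)) n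
      ≡⟨ cong (_+ (q^ suc m · signedQ (suc m)) n) (trans (signedQ′-suc 0 m n) (shiftSum-unfold m (λ j → signedQ′ j m) n)) ⟩
    signedQ m n + (q^ suc m · shiftSum (suc m) (λ j → signedQ′ (suc j) m)) n + (q^ suc m · signedQ (suc m)) n
      ≡⟨ cong (λ z → signedQ m n + z + (q^ suc m · signedQ (suc m)) n) (q^-cong (suc m) (≗.sym (signedQ′-suc 1 m)) n) ⟩
    signedQ m n + (q^ suc m · signedQ′ 1 (suc m)) n + (q^ suc m · signedQ (suc m)) n
      ≡⟨ cong (λ z → signedQ m n + z + (q^ suc m · signedQ (suc m)) n) (q^-cong (suc m) opposite n) ⟩
    signedQ m n + (q^ suc m · ((- 1ℤ) ⊙ signedQ (suc m))) n + (q^ suc m · signedQ (suc m)) n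
      ≡⟨ cong (λ z → signedQ m n + z + (q^ suc m · signedQ (suc m)) n) (q^-⊙ (suc m) (- 1ℤ) (signedQ (suc m)) n) ⟩
    signedQ m n + (- 1ℤ) * (q^ suc m · signedQ (suc m)) n + (q^ suc m · signedQ (suc m)) n
      ≡⟨ cancel (signedQ m n) _ ⟩
    signedQ m n ∎
    where
    open ≡-Reasoning
    opposite : signedQ′ 1 (suc m) ≗ (- 1ℤ) ⊙ signedQ (suc m)
    opposite x = trans (∑∈-neg (λ μ → sign (length μ)) (parts x (suc m))) (sym (ℤ.-1*i≡-i _))
    cancel : ∀ a b → a + (- 1ℤ) * b + b ≡ a
    cancel = solve-∀

  signedQ-stable-suc : ∀ a M → M ≤ a → signedQ (suc a) M ≡ signedQ a M
  signedQ-stable-suc a M M≤a = begin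
    signedQ (suc a) M
      ≡⟨ ℤ.+-identityʳ _ ⟨
    signedQ (suc a) M + 0ℤ
      ≡⟨ cong (λ z → signedQ (suc a) M + z) (q^-below (suc a) (signedQ (suc a)) (s≤s M≤a)) ⟨
    signedQ (suc a) M + (q^ suc a · signedQ (suc a)) M
      ≡⟨ 1+q^-signedQ a M ⟩
    signedQ a M ∎
    where open ≡-Reasoning

  signedQ-stable : ∀ a M → M ≤ a → signedQ a M ≡ signedQ M M
  signedQ-stable = coefficient-stable signedQ signedQ-stable-suc

  evenProduct : ℕ → ℕ → Series → Series
  evenProduct s zero X = X
  evenProduct s (suc l) X = 1-q^ (s +ℕ s) · evenProduct (suc s) l X

  evenProduct-shiftLinear : ∀ s l → ShiftLinear (evenProduct s l)
  evenProduct-shiftLinear s zero = id-shiftLinear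
  evenProduct-shiftLinear s (suc l) = ∘-shiftLinear (1-q^-shiftLinear (s +ℕ s)) (evenProduct-shiftLinear (suc s) l)

  evenProduct-last : ∀ s l X → evenProduct s (suc l) X ≗ 1-q^ ((s +ℕ l) +ℕ (s +ℕ l)) · evenProduct s l X
  evenProduct-last s zero X = 1-q^-exponent X (cong (λ k → k +ℕ k) (sym (ℕ.+-identityʳ s)))
  evenProduct-last s (suc l) X = begin
    1-q^ (s +ℕ s) · evenProduct (suc s) (suc l) X
      ≈⟨ cong-≗ (1-q^-shiftLinear (s +ℕ s)) (evenProduct-last (suc s) l X) ⟩
    1-q^ (s +ℕ s) · 1-q^ A · evenProduct (suc s) l X
      ≈⟨ 1-q^-comm (s +ℕ s) A (evenProduct (suc s) l X) ⟩
    1-q^ A · 1-q^ (s +ℕ s) · evenProduct (suc s) l X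
      ≈⟨ 1-q^-exponent (evenProduct s (suc l) X) (cong (λ k → k +ℕ k) (sym (ℕ.+-suc s l))) ⟩
    1-q^ ((s +ℕ suc l) +ℕ (s +ℕ suc l)) · evenProduct s (suc l) X ∎
    where
    open ≗-Reasoning
    A = (suc s +ℕ l) +ℕ (suc s +ℕ l)

  evenProduct-low : ∀ s l X N → N < s +ℕ s → evenProduct s l X N ≡ X N
  evenProduct-low s zero X N _ = refl
  evenProduct-low s (suc l) X N N<2s =
    trans (cong₂ _-_ (evenProduct-low (suc s) l X N (ℕ.<-≤-trans N<2s (ℕ.+-mono-≤ (ℕ.n≤1+n s) (ℕ.n≤1+n s))))
                     (q^-below (s +ℕ s) _ N<2s))
          (ℤ.+-identityʳ _)

  -- clearedSignedQ r = Π_{k ≤ 2r} 1/(1 + q^k) · Π_{r < i ≤ 2r} (1 − q^(2i)) is Π_{i ≤ r} (1 − q^(2i−1)),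
  -- as 1/(1 + q^k) = (1 − q^k)/(1 − q^(2k)); the inductive step is checked after multiplying by 1 − q^(2r+2).
  clearedSignedQ : ℕ → Series
  clearedSignedQ r = evenProduct (suc r) r (signedQ (r +ℕ r))

  clearedSignedQ-suc : ∀ r → clearedSignedQ (suc r) ≗ 1-q^ suc (r +ℕ r) · clearedSignedQ r
  clearedSignedQ-suc r = 1-q^-cancel k₁ (≗.trans lhs (≗.sym rhs))
    where
    open ≗-Reasoning
    k₁ = suc (r +ℕ r)
    k₂ = suc k₁
    X = signedQ k₂
    Y = evenProduct (suc r) r X
    Φ = evenProduct (suc r) r
    Φ-linear = evenProduct-shiftLinear (suc r) r
    lhs : 1-q^ k₂ · clearedSignedQ (suc r) ≗ 1-q^ (k₂ +ℕ k₂) · 1-q^ (k₁ +ℕ k₁) · Y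
    lhs = begin
      1-q^ k₂ · evenProduct (suc (suc r)) (suc r) (signedQ (suc r +ℕ suc r))
        ≈⟨ cong-≗ (∘-shiftLinear (1-q^-shiftLinear k₂) (evenProduct-shiftLinear (suc (suc r)) (suc r)))
                  (λ n → cong (λ i → signedQ i n) (cong suc (ℕ.+-suc r r))) ⟩
      1-q^ k₂ · evenProduct (suc (suc r)) (suc r) X
        ≈⟨ 1-q^-exponent (evenProduct (suc (suc r)) (suc r) X) (cong suc (sym (ℕ.+-suc r r))) ⟩
      evenProduct (suc r) (suc (suc r)) X
        ≈⟨ evenProduct-last (suc r) (suc r) X ⟩
      1-q^ ((suc r +ℕ suc r) +ℕ (suc r +ℕ suc r)) · evenProduct (suc r) (suc r) X
        ≈⟨ cong-≗ (1-q^-shiftLinear ((suc r +ℕ suc r) +ℕ (suc r +ℕ suc r))) (evenProduct-last (suc r) r X) ⟩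
      1-q^ ((suc r +ℕ suc r) +ℕ (suc r +ℕ suc r)) · 1-q^ ((suc r +ℕ r) +ℕ (suc r +ℕ r)) · Y
        ≈⟨ ≗.trans (1-q^-exponent (1-q^ ((suc r +ℕ r) +ℕ (suc r +ℕ r)) · Y) (outer r))
                   (cong-≗ (1-q^-shiftLinear (k₂ +ℕ k₂)) (1-q^-exponent Y (inner r))) ⟩
      1-q^ (k₂ +ℕ k₂) · 1-q^ (k₁ +ℕ k₁) · Y ∎
      where
      outer : ∀ r → (suc r +ℕ suc r) +ℕ (suc r +ℕ suc r) ≡ suc (suc (r +ℕ r)) +ℕ suc (suc (r +ℕ r))
      outer = ℕ-solve-∀
      inner : ∀ r → (suc r +ℕ r) +ℕ (suc r +ℕ r) ≡ suc (r +ℕ r) +ℕ suc (r +ℕ r)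
      inner = ℕ-solve-∀
    rhs : 1-q^ k₂ · 1-q^ k₁ · clearedSignedQ r ≗ 1-q^ (k₂ +ℕ k₂) · 1-q^ (k₁ +ℕ k₁) · Y
    rhs = begin
      1-q^ k₂ · 1-q^ k₁ · Φ (signedQ (r +ℕ r))
        ≈⟨ cong-≗ (∘-shiftLinear (1-q^-shiftLinear k₂) (∘-shiftLinear (1-q^-shiftLinear k₁) Φ-linear)) (≗.sym unfolded) ⟩
      1-q^ k₂ · 1-q^ k₁ · Φ (1+q^ k₁ · 1+q^ k₂ · X)
        ≈⟨ cong-≗ (∘-shiftLinear (1-q^-shiftLinear k₂) (1-q^-shiftLinear k₁))
                  (≗.trans (comm-1+q^ Φ-linear k₁ _) (cong-≗ (1+q^-shiftLinear k₁) (comm-1+q^ Φ-linear k₂ X))) ⟩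
      1-q^ k₂ · 1-q^ k₁ · 1+q^ k₁ · 1+q^ k₂ · Y
        ≈⟨ cong-≗ (1-q^-shiftLinear k₂) (1-q^-1+q^ k₁ (1+q^ k₂ · Y)) ⟩
      1-q^ k₂ · 1-q^ (k₁ +ℕ k₁) · 1+q^ k₂ · Y
        ≈⟨ 1-q^-comm k₂ (k₁ +ℕ k₁) (1+q^ k₂ · Y) ⟩
      1-q^ (k₁ +ℕ k₁) · 1-q^ k₂ · 1+q^ k₂ · Y
        ≈⟨ cong-≗ (1-q^-shiftLinear (k₁ +ℕ k₁)) (1-q^-1+q^ k₂ Y) ⟩
      1-q^ (k₁ +ℕ k₁) · 1-q^ (k₂ +ℕ k₂) · Y
        ≈⟨ 1-q^-comm (k₁ +ℕ k₁) (k₂ +ℕ k₂) Y ⟩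
      1-q^ (k₂ +ℕ k₂) · 1-q^ (k₁ +ℕ k₁) · Y ∎
      where
      unfolded : 1+q^ k₁ · 1+q^ k₂ · X ≗ signedQ (r +ℕ r)
      unfolded = ≗.trans (cong-≗ (1+q^-shiftLinear k₁) (1+q^-signedQ k₁)) (1+q^-signedQ (r +ℕ r))

  clearedSignedQ≗oddProduct : ∀ r → clearedSignedQ r ≗ oddProduct r
  clearedSignedQ≗oddProduct zero = signedQ-zero
  clearedSignedQ≗oddProduct (suc r) =
    ≗.trans (clearedSignedQ-suc r) (cong-≗ (1-q^-shiftLinear (suc (r +ℕ r))) (clearedSignedQ≗oddProduct r))

  signedQ≡oddProduct : ∀ N → signedQ N N ≡ oddProduct N N
  signedQ≡oddProduct N = begin
    signedQ N N
      ≡⟨ signedQ-stable (N +ℕ N) N (ℕ.m≤m+n N N) ⟨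
    signedQ (N +ℕ N) N
      ≡⟨ evenProduct-low (suc N) N (signedQ (N +ℕ N)) N (ℕ.≤-trans (ℕ.n<1+n N) (ℕ.m≤m+n (suc N) (suc N))) ⟨
    clearedSignedQ N N
      ≡⟨ clearedSignedQ≗oddProduct N N ⟩
    oddProduct N N ∎
    where open ≡-Reasoning

  +-pₑ : ∀ n → + pₑ n ≡ ∑[ μ ∈ partitions n ] indicator (Even? (length μ))
  +-pₑ n = trans (+-length-filter (λ μ → Even? (length μ) Bool.≟ true) (partitions n))
                 (∑∈-cong (All.universal (λ μ → does-≟-true (Even? (length μ))) (partitions n)))
    where
    does-≟-true : ∀ b → indicator (does (b Bool.≟ true)) ≡ indicator b
    does-≟-true true = refl
    does-≟-true false = refl

  sign-parity : ∀ l → sign l ≡ indicator (Even? l) + indicator (Even? l) - 1ℤ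
  sign-parity zero = refl
  sign-parity (suc zero) = refl
  sign-parity (suc (suc l)) = trans (ℤ.neg-involutive (sign l)) (sign-parity l)

  signedQ-coefficient : ∀ n → signedQ n n ≡ + pₑ n + + pₑ n - + p n
  signedQ-coefficient n = begin
    ∑[ μ ∈ partitions n ] sign (length μ)
      ≡⟨ ∑∈-cong (All.universal (λ μ → sign-parity (length μ)) (partitions n)) ⟩
    ∑[ μ ∈ partitions n ] (e μ + e μ - 1ℤ)
      ≡⟨ linear (partitions n) ⟩
    ∑∈ e (partitions n) + ∑∈ e (partitions n) - ∑[ μ ∈ partitions n ] 1ℤ
      ≡⟨ cong₂ (λ a b → a + a - b) (+-pₑ n) (+-length (partitions n)) ⟨
    + pₑ n + + pₑ n - + p n ∎
    where
    open ≡-Reasoning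
    e : List ℕ → ℤ
    e μ = indicator (Even? (length μ))
    linear : ∀ μs → ∑[ μ ∈ μs ] (e μ + e μ - 1ℤ) ≡ ∑∈ e μs + ∑∈ e μs - ∑[ μ ∈ μs ] 1ℤ
    linear [] = refl
    linear (μ ∷ μs) = trans (cong (λ z → (e μ + e μ - 1ℤ) + z) (linear μs)) (regroup (e μ) (∑∈ e μs) (∑[ μ ∈ μs ] 1ℤ))
      where
      regroup : ∀ u v w → (u + u - 1ℤ) + (v + v - w) ≡ (u + v) + (u + v) - (1ℤ + w)
      regroup = solve-∀

module SquareSums where

  open import Data.Integer using (ℤ; +_; -_; 0ℤ; 1ℤ; _+_; _-_; _*_)
  open import Data.Nat using (_^_)
  open PowerSeries
  open FiniteSums
  open ShiftSums
  open Partitions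
  open SmallestGap using (S₂+G₂≡staircases)
  open GaussIdentity using (sign; sign-+; sign-*; square; n≤square; gaussSum≗oddProduct)
  open GaussCoefficient
  open EulerProduct using (signedQ; signedQ-coefficient; signedQ≡oddProduct)

  pSquare : ℕ → ℕ → ℕ
  pSquare n k = if square k ≤ᵇ n then p (n ∸ square k) else 0

  q^-square-Q : ∀ n k → (q^ square k · Q n) n ≡ + pSquare n k
  q^-square-Q n k with square k ≤? n
  ... | yes k²≤n rewrite q^-coeff (square k) (Q n) n | ≤ᵇ-true k²≤n =
    trans (Q-stable n (n ∸ square k) (ℕ.m∸n≤m n (square k))) (sym (p≡Q (n ∸ square k)))
  ... | no k²≰n rewrite q^-coeff (square k) (Q n) n | ≤ᵇ-false (ℕ.≰⇒> k²≰n) = refl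

  pSquare-beyond : ∀ n k → n < k → pSquare n k ≡ 0
  pSquare-beyond n k n<k = cong (λ b → if b then p (n ∸ square k) else 0) (≤ᵇ-false (ℕ.<-≤-trans n<k (n≤square k)))

  sumP≡∑pSquare : ∀ (f h : ℕ → ℕ) n → (∀ k → f k ≡ square (h k)) → + sumP f n ≡ ∑[ k < suc n ] (+ pSquare n (h k))
  sumP≡∑pSquare f h n f≡h² = begin
    + sumP f n
      ≡⟨ +-sum-map summand (upTo (suc n)) ⟩
    ∑[ k ∈ upTo (suc n) ] (+ summand k)
      ≡⟨ ∑∈-applyUpTo (λ k → + summand k) (λ k → k) (suc n) ⟩
    ∑[ k < suc n ] (+ summand k)
      ≡⟨ ∑-cong (suc n) (λ k _ → cong (λ e → + (if e ≤ᵇ n then p (n ∸ e) else 0)) (f≡h² k)) ⟩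
    ∑[ k < suc n ] (+ pSquare n (h k)) ∎
    where
    open ≡-Reasoning
    summand : ℕ → ℕ
    summand k = if f k ≤ᵇ n then p (n ∸ f k) else 0

  even-odd : ∀ n (a : ℕ → ℤ) → (∀ k → n < k → a k ≡ 0ℤ) → ∑[ k < suc n ] a k ≡ ∑[ k < suc n ] a (2 *ℕ k) + ∑[ k < suc n ] a (2 *ℕ k +ℕ 1)
  even-odd n a beyond = trans (sym (∑-trailing-zeros (suc n) (suc n) a beyond)) (∑-even-odd (suc n) a)

  even-sum odd-sum : ℕ → ℤ
  even-sum n = ∑[ k < suc n ] (+ pSquare n (2 *ℕ k))
  odd-sum n = ∑[ k < suc n ] (+ pSquare n (2 *ℕ k +ℕ 1))

  +-sumP-even : ∀ n → + sumP (λ k → (2 *ℕ k) ^ 2) n ≡ even-sum n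
  +-sumP-even n = sumP≡∑pSquare _ (λ k → 2 *ℕ k) n (λ k → cong ((2 *ℕ k) *ℕ_) (ℕ.*-identityʳ (2 *ℕ k)))

  +-sumP-odd : ∀ n → + sumP (λ k → (2 *ℕ k +ℕ 1) ^ 2) n ≡ odd-sum n
  +-sumP-odd n = sumP≡∑pSquare _ (λ k → 2 *ℕ k +ℕ 1) n (λ k → cong ((2 *ℕ k +ℕ 1) *ℕ_) (ℕ.*-identityʳ (2 *ℕ k +ℕ 1)))

  S₂+G₂≡even+odd : ∀ n → + S₂ n + + G₂ n ≡ even-sum n + odd-sum n
  S₂+G₂≡even+odd n = begin
    + S₂ n + + G₂ n                            ≡⟨ S₂+G₂≡staircases n ⟩
    ∑[ k < suc n ] (q^ square k · Q n) n       ≡⟨ ∑-cong (suc n) (λ k _ → q^-square-Q n k) ⟩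
    ∑[ k < suc n ] (+ pSquare n k)               ≡⟨ even-odd n (λ k → + pSquare n k) (λ k n<k → cong +_ (pSquare-beyond n k n<k)) ⟩
    even-sum n + odd-sum n                     ∎
    where open ≡-Reasoning

  pₑ≡alternating-sum : ∀ n → + pₑ n ≡ ∑[ k < suc n ] (sign k * + pSquare n k)
  pₑ≡alternating-sum n = ℤ.*-cancelˡ-≡ (+ 2) _ _ (begin
    + 2 * + pₑ n
      ≡⟨ regroup (+ pₑ n) (+ p n) ⟩
    (+ pₑ n + + pₑ n - + p n) + + p n
      ≡⟨ cong₂ _+_ (sym (signedQ-coefficient n)) (p≡Q n) ⟩
    signedQ n n + Q n n
      ≡⟨ cong (_+ Q n n) (trans (signedQ≡oddProduct n) (trans (sym (gaussSum≗oddProduct n n)) (gaussSum-coefficient n))) ⟩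
    (signedTerm n 0 + (S + S)) + Q n n
      ≡⟨ cong (λ t → (t + (S + S)) + Q n n) (ℤ.*-identityˡ (Q n n)) ⟩
    (Q n n + (S + S)) + Q n n
      ≡⟨ regroup′ (Q n n) S ⟩
    + 2 * (signedTerm n 0 + S)
      ≡⟨ cong (+ 2 *_) all-terms ⟩
    + 2 * ∑[ k < suc n ] (sign k * + pSquare n k) ∎)
    where
    open ≡-Reasoning
    S = ∑[ j < suc n ] signedTerm n (suc j)
    regroup : ∀ e q → + 2 * e ≡ (e + e - q) + q
    regroup = solve-∀
    regroup′ : ∀ q s → (q + (s + s)) + q ≡ + 2 * (1ℤ * q + s)
    regroup′ = solve-∀
    all-terms : signedTerm n 0 + S ≡ ∑[ k < suc n ] (sign k * + pSquare n k)
    all-terms = begin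
      ∑[ k < suc (suc n) ] signedTerm n k
        ≡⟨ ∑-last (suc n) (signedTerm n) ⟩
      ∑[ k < suc n ] signedTerm n k + signedTerm n (suc n)
        ≡⟨ cong (λ z → ∑[ k < suc n ] signedTerm n k + z) (signedTerm-beyond n (suc n) ℕ.≤-refl) ⟩
      ∑[ k < suc n ] signedTerm n k + 0ℤ
        ≡⟨ ℤ.+-identityʳ _ ⟩
      ∑[ k < suc n ] signedTerm n k
        ≡⟨ ∑-cong (suc n) (λ k _ → cong (sign k *_) (q^-square-Q n k)) ⟩
      ∑[ k < suc n ] (sign k * + pSquare n k) ∎

  sign-2* : ∀ k → sign (2 *ℕ k) ≡ 1ℤ
  sign-2* k = trans (cong sign (cong (k +ℕ_) (ℕ.+-identityʳ k))) (trans (sign-+ k k) (sign-* k))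

  pₑ≡even−odd : ∀ n → + pₑ n ≡ even-sum n - odd-sum n
  pₑ≡even−odd n = begin
    + pₑ n
      ≡⟨ pₑ≡alternating-sum n ⟩
    ∑[ k < suc n ] (sign k * P k)
      ≡⟨ even-odd n (λ k → sign k * P k) vanishing ⟩
    ∑[ k < suc n ] (sign (2 *ℕ k) * P (2 *ℕ k)) + ∑[ k < suc n ] (sign (2 *ℕ k +ℕ 1) * P (2 *ℕ k +ℕ 1))
      ≡⟨ cong₂ _+_ even-terms odd-terms ⟩
    even-sum n - odd-sum n ∎
    where
    open ≡-Reasoning
    P : ℕ → ℤ
    P k = + pSquare n k
    vanishing : ∀ k → n < k → sign k * P k ≡ 0ℤ
    vanishing k n<k = trans (cong (λ x → sign k * + x) (pSquare-beyond n k n<k)) (ℤ.*-zeroʳ (sign k))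
    even-terms : ∑[ k < suc n ] (sign (2 *ℕ k) * P (2 *ℕ k)) ≡ even-sum n
    even-terms = ∑-cong (suc n) (λ k _ → trans (cong (_* P (2 *ℕ k)) (sign-2* k)) (ℤ.*-identityˡ (P (2 *ℕ k))))
    odd-sign : ∀ k → sign (2 *ℕ k +ℕ 1) ≡ - 1ℤ
    odd-sign k = trans (cong sign (ℕ.+-comm (2 *ℕ k) 1)) (cong -_ (sign-2* k))
    odd-terms : ∑[ k < suc n ] (sign (2 *ℕ k +ℕ 1) * P (2 *ℕ k +ℕ 1)) ≡ - odd-sum n
    odd-terms = begin
      ∑[ k < suc n ] (sign (2 *ℕ k +ℕ 1) * P (2 *ℕ k +ℕ 1))   ≡⟨ ∑-cong (suc n) (λ k _ → cong (_* P (2 *ℕ k +ℕ 1)) (odd-sign k)) ⟩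
      ∑[ k < suc n ] ((- 1ℤ) * P (2 *ℕ k +ℕ 1))              ≡⟨ ∑-*ˡ (suc n) (- 1ℤ) (λ k → P (2 *ℕ k +ℕ 1)) ⟩
      (- 1ℤ) * odd-sum n                                     ≡⟨ ℤ.-1*i≡-i (odd-sum n) ⟩
      - odd-sum n                                            ∎

  S₂+G₂≡sumP-even+sumP-odd : ∀ n → S₂ n +ℕ G₂ n ≡ sumP (λ k → (2 *ℕ k) ^ 2) n +ℕ sumP (λ k → (2 *ℕ k +ℕ 1) ^ 2) n
  S₂+G₂≡sumP-even+sumP-odd n = ℤ.+-injective (begin
    + (S₂ n +ℕ G₂ n)                                                     ≡⟨ ℤ.pos-+ (S₂ n) (G₂ n) ⟩
    + S₂ n + + G₂ n                                                      ≡⟨ S₂+G₂≡even+odd n ⟩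
    even-sum n + odd-sum n                                               ≡⟨ cong₂ _+_ (+-sumP-even n) (+-sumP-odd n) ⟨
    + sumP (λ k → (2 *ℕ k) ^ 2) n + + sumP (λ k → (2 *ℕ k +ℕ 1) ^ 2) n   ≡⟨ ℤ.pos-+ (sumP (λ k → (2 *ℕ k) ^ 2) n) _ ⟨
    + (sumP (λ k → (2 *ℕ k) ^ 2) n +ℕ sumP (λ k → (2 *ℕ k +ℕ 1) ^ 2) n)  ∎)
    where open ≡-Reasoning

  pₑ+sumP-odd≡sumP-even : ∀ n → pₑ n +ℕ sumP (λ k → (2 *ℕ k +ℕ 1) ^ 2) n ≡ sumP (λ k → (2 *ℕ k) ^ 2) n
  pₑ+sumP-odd≡sumP-even n = ℤ.+-injective (begin
    + (pₑ n +ℕ sumP (λ k → (2 *ℕ k +ℕ 1) ^ 2) n)          ≡⟨ ℤ.pos-+ (pₑ n) _ ⟩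
    + pₑ n + + sumP (λ k → (2 *ℕ k +ℕ 1) ^ 2) n           ≡⟨ cong₂ _+_ (pₑ≡even−odd n) (+-sumP-odd n) ⟩
    even-sum n - odd-sum n + odd-sum n                    ≡⟨ cancel (even-sum n) (odd-sum n) ⟩
    even-sum n                                            ≡⟨ +-sumP-even n ⟨
    + sumP (λ k → (2 *ℕ k) ^ 2) n                         ∎)
    where
    open ≡-Reasoning
    cancel : ∀ e o → e - o + o ≡ e
    cancel = solve-∀

open import Data.Nat using (_+_; _*_; _^_)
open SquareSums using (S₂+G₂≡sumP-even+sumP-odd; pₑ+sumP-odd≡sumP-even)

corollary5 : (n : ℕ) →
    (2 * sumP (λ k → (2 * k) ^ 2) n ≡ S₂ n + G₂ n + pₑ n)
    × (2 * sumP (λ k → (2 * k + 1) ^ 2) n + pₑ n ≡ S₂ n + G₂ n)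
corollary5 n = even-identity , odd-identity
  where
  open ≡-Reasoning
  E = sumP (λ k → (2 * k) ^ 2) n
  O = sumP (λ k → (2 * k + 1) ^ 2) n
  even-identity : 2 * E ≡ S₂ n + G₂ n + pₑ n
  even-identity = begin
    2 * E              ≡⟨ cong (E +_) (ℕ.+-identityʳ E) ⟩
    E + E              ≡⟨ cong (E +_) (pₑ+sumP-odd≡sumP-even n) ⟨
    E + (pₑ n + O)     ≡⟨ cong (E +_) (ℕ.+-comm (pₑ n) O) ⟩
    E + (O + pₑ n)     ≡⟨ ℕ.+-assoc E O (pₑ n) ⟨
    E + O + pₑ n       ≡⟨ cong (_+ pₑ n) (S₂+G₂≡sumP-even+sumP-odd n) ⟨
    S₂ n + G₂ n + pₑ n ∎
  odd-identity : 2 * O + pₑ n ≡ S₂ n + G₂ n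
  odd-identity = begin
    2 * O + pₑ n       ≡⟨ cong (λ x → O + x + pₑ n) (ℕ.+-identityʳ O) ⟩
    O + O + pₑ n       ≡⟨ ℕ.+-assoc O O (pₑ n) ⟩
    O + (O + pₑ n)     ≡⟨ cong (O +_) (trans (ℕ.+-comm O (pₑ n)) (pₑ+sumP-odd≡sumP-even n)) ⟩
    O + E              ≡⟨ ℕ.+-comm O E ⟩
    E + O              ≡⟨ S₂+G₂≡sumP-even+sumP-odd n ⟨
    S₂ n + G₂ n        ∎
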